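{- Let $d\ge1$, $r\ge 2$, let $e_1,\dots,e_{r-1}\ge 2$ be integers with $\sum_{j=1}^{r-1}(e_j-1)=d-1$, let $\tau=(1\,2\,\cdots\,d)$, let $S=\{s_1<\cdots<s_{r-1}\}$ be a set of positive integers disjoint from $\{0,1,\dots,d\}$, and let $(M,\ell)$ be a labeled multi-noded rooted tree of vertex data $(1,e_1-1,\dots,e_{r-1}-1)$. Then $(M,\ell)\in\mathrm{LMR}^*_S(1,e_1-1,\dots,e_{r-1}-1)$ if and only if there exist integers $1\le\alpha_\nu\le\beta_\nu\le d$ for each node $\nu$ of $M$ and $1\le\alpha'_j\le\beta'_j\le d$ for each vertex $s_j$ ($0\le j\le r-1$) such that: (i) for every node $\nu$, $\ell(M_\nu)=[\alpha_\nu,\beta_\nu]=\{\alpha_\nu,\alpha_\nu+1,\dots,\beta_\nu\}$; (ii) for every vertex $s_j$, $\ell(M_{s_j})=[\alpha'_j,\beta'_j]$; (iii) if $\nu$ is a node of the vertex $s_j$ and $s_{j_1},\dots,s_{j_\ell}$ are the vertices attached to $\nu$, with $j_1<\cdots<j_k<j<j_{k+1}<\cdots<j_\ell$ for some $0\le k\le\ell$, then $\{\ell(\nu)\},[\alpha'_{j_1},\beta'_{j_1}],\dots,[\alpha'_{j_\ell},\beta'_{j_\ell}]$ partition $[\alpha_\nu,\beta_\nu]$ into consecutive intervals with $\beta'_{j_k}<\cdots<\beta'_{j_1}<\ell(\nu)<\beta'_{j_\ell}<\cdots<\beta'_{j_{k+1}}$; (iv) if $s_j$ is a vertex with nodes $\nu_1,\dots,\nu_{f_j}$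 from left to right, then $[\alpha_{\nu_1},\beta_{\nu_1}],\dots,[\alpha_{\nu_{f_j}},\beta_{\nu_{f_j}}]$ partition $[\alpha'_j,\beta'_j]$ into consecutive intervals with $\beta_{\nu_1}<\cdots<\beta_{\nu_{f_j}}$.
   Context: Permutations compose right-to-left. A factorization of $\tau$ of type $(e_1,\dots,e_{r-1})$ is a tuple $(\sigma_1,\dots,\sigma_{r-1})$ with each $\sigma_i\in S_d$ an $e_i$-cycle and $\sigma_1\cdots\sigma_{r-1}=\tau$; its factorization graph has vertex set $S\cup[d]$ and edges $\{s_j,\nu\}$ for $\nu\in\mathrm{supp}(\sigma_j)$ (it is a tree). Set $s_0=0$, $f_0=1$, $f_i=e_i-1$. A multi-noded rooted tree of vertex data $(f_0,\dots,f_{r-1})$ is $M=(T,\beta)$, $T$ a tree on $S\cup\{0\}$ rooted at $0$, $\beta$ assigning to each edge whose parent end is $s_i$ a value in $\{1,\dots,f_i\}$. Its nodes are the pairs $(s_i,k)$, $1\le k\le f_i$, ordered left to right by $k$; a child $s_j$ of $s_i$ is attached to the node $(s_i,\beta(\{s_i,s_j\}))$. A labeled multi-noded rooted tree is $(M,\ell)$ with $\ell$ a bijection from the $d$ nodes to $[d]$. For a vertex $s$, $M_s$ is the set of nodes of $s$ and of all its descendants in $T$; for a node $\nu$ of vertex $s$, $M_\nu$ is $\{\nu\}$ together with $M_{s'}$ for all vertices $s'$ attached to $\nu$. $\ell(X)$ denotes the set of labels of the nodes in $X$. $\Phi^L$: root a factorization graph $G$ at vertex $1$ to get $G^R$; for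 $i\ge1$ let $\nu_1<\cdots<\nu_{e_i-1}$ be the children and $\nu$ the parent of $s_i$ in $G^R$. $\Phi^L(G)=(M,\ell)$ where the parent of $s_i$ in $T$ is $0$ (with $\beta=1$) if $\nu=1$, and otherwise is the parent $s_j$ of $\nu$ in $G^R$ with $\beta(\{s_j,s_i\})=k$ where $\nu$ is the $k$-th smallest child of $s_j$; and $\ell(0,1)=1$, $\ell(s_i,k)=\nu_k$. $\mathrm{LMR}^*_S(1,e_1-1,\dots,e_{r-1}-1)$ is the set of all $\Phi^L(G)$ over factorization graphs $G$ of factorizations of $\tau$ of type $(e_1,\dots,e_{r-1})$. -}

module Defs where

open import Data.Nat using (ℕ; zero; suc; _+_; _∸_; _≤_; _<_; _≡ᵇ_; _<ᵇ_)
open import Data.Nat.DivMod using (_mod_)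
open import Data.Fin using (Fin; zero; suc; toℕ)
open import Data.List using (List; []; _∷_; _++_; map; reverse; filterᵇ; allFin)
open import Data.Bool using (Bool; true; false; _∧_)
open import Data.Product using (Σ; Σ-syntax; ∃; ∃-syntax; _×_; _,_; proj₁; proj₂)
open import Data.Sum using (_⊎_; inj₁; inj₂)
open import Relation.Binary.PropositionalEquality using (_≡_; _≢_)
open import Function.Definitions using (Injective)

-- Conventions
--   d = suc m ; the label set [d] = {1,…,d} is represented by Fin (suc m),
--   the element x : Fin (suc m) standing for the label toℕ x + 1.
--   r = suc n ; the vertex set S ∪ {0} of the multi-noded tree is
--   Fin (suc n): zero is s_0 = 0 and suc i is s_{i+1}.
--   e : Fin n → ℕ, e i is e_{i+1}.

iter : ∀ {A : Set} → (A → A) → ℕ → A → A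
iter f zero x = x
iter f (suc t) x = f (iter f t x)

-- right-to-left product σ_1 ⋯ σ_n (σ_n is applied first)
prod : ∀ {A : Set} {n} → (Fin n → A → A) → A → A
prod {n = zero} σ x = x
prod {n = suc n} σ x = σ zero (prod (λ i → σ (suc i)) x)

tau : (m : ℕ) → Fin (suc m) → Fin (suc m)
tau m x = suc (toℕ x) mod suc m

IsCycle : ∀ {d} → ℕ → (Fin d → Fin d) → Set
IsCycle {d} e σ =
  Σ[ c ∈ (Fin e → Fin d) ]
    ( Injective _≡_ _≡_ c
    × (∀ k j → (toℕ j ≡ suc (toℕ k) ⊎ (toℕ j ≡ 0 × suc (toℕ k) ≡ e)) → σ (c k) ≡ c j)
    × (∀ x → (∀ k → c k ≢ x) → σ x ≡ x))

record Factorization (n m : ℕ) (e : Fin n → ℕ) : Set where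
  field
    σ       : Fin n → Fin (suc m) → Fin (suc m)
    cyc     : ∀ i → IsCycle (e i) (σ i)
    product : ∀ x → prod σ x ≡ tau m x

-- Rooting G^R of the factorization graph G at the label vertex 1 (= zero).
-- Vertices of G: inj₁ x (x ∈ [d]) and inj₂ i (i.e. s_{i+1} ∈ S);
-- edge {s_i, x} iff σ_i x ≠ x.
-- pS i : parent of s_i ; pL y : parent of the label vertex suc y (≠ 1).
gstep : ∀ {n m} → (Fin n → Fin (suc m)) → (Fin m → Fin n) →
        Fin (suc m) ⊎ Fin n → Fin (suc m) ⊎ Fin n
gstep pS pL (inj₁ zero)    = inj₁ zero
gstep pS pL (inj₁ (suc y)) = inj₂ (pL y)
gstep pS pL (inj₂ i)       = inj₁ (pS i)

record Rooting {n m : ℕ} {e : Fin n → ℕ} (F : Factorization n m e) : Set where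
  open Factorization F
  field
    pS     : Fin n → Fin (suc m)
    pL     : Fin m → Fin n
    pS-adj : ∀ i → σ i (pS i) ≢ pS i
    pL-adj : ∀ y → σ (pL y) (suc y) ≢ suc y
    edges  : ∀ i x → σ i x ≢ x → pS i ≡ x ⊎ Σ[ y ∈ Fin m ] (x ≡ suc y × pL y ≡ i)
    rooted : ∀ v → ∃[ t ] iter (gstep pS pL) t v ≡ inj₁ zero

vdata : ∀ {n} → (Fin n → ℕ) → Fin (suc n) → ℕ
vdata e zero    = 1
vdata e (suc i) = e i ∸ 1

tpar : ∀ {n} → (Fin n → Fin (suc n)) → Fin (suc n) → Fin (suc n)
tpar p zero    = zero
tpar p (suc i) = p i

-- parent i : parent of s_{i+1} in T ; β i : β({parent, s_{i+1}})
record MNTree (n : ℕ) (f : Fin (suc n) → ℕ) : Set where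
  field
    parent  : Fin n → Fin (suc n)
    β       : Fin n → ℕ
    β-range : ∀ i → 1 ≤ β i × β i ≤ f (parent i)
    rooted  : ∀ v → ∃[ t ] iter (tpar parent) t v ≡ zero

-- nodes (v , k) : node number toℕ k + 1 of vertex v
Node : ∀ {n} → (Fin (suc n) → ℕ) → Set
Node {n} f = Σ (Fin (suc n)) (λ v → Fin (f v))

IsPhiL : ∀ {n m} {e : Fin n → ℕ} (F : Factorization n m e) (R : Rooting F)
         (M : MNTree n (vdata e)) (ℓ : Node (vdata e) → Fin (suc m)) → Set
IsPhiL {n} {m} {e} F R M ℓ =
  -- ch i : the children ν_1 < ⋯ < ν_{e_i - 1} of s_i in G^R
  Σ[ ch ∈ ((i : Fin n) → Fin (e i ∸ 1) → Fin (suc m)) ]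
    ( (∀ i k k′ → toℕ k < toℕ k′ → toℕ (ch i k) < toℕ (ch i k′))
    × (∀ i x → Σ[ y ∈ Fin m ] (x ≡ suc y × pL y ≡ i) → ∃[ k ] ch i k ≡ x)
    × (∀ i k → Σ[ y ∈ Fin m ] (ch i k ≡ suc y × pL y ≡ i))
    × ℓ (zero , zero) ≡ zero
    × (∀ i k → ℓ (suc i , k) ≡ ch i k)
    × (∀ i → (pS i ≡ zero → parent i ≡ zero × β i ≡ 1)
           × (∀ y → pS i ≡ suc y →
                parent i ≡ suc (pL y)
                × Σ[ k ∈ Fin (e (pL y) ∸ 1) ] (ch (pL y) k ≡ suc y × suc (toℕ k) ≡ β i))))
  where
    open Rooting R
    open MNTree M

InLMR : ∀ {n m} {e : Fin n → ℕ} → MNTree n (vdata e) → (Node (vdata e) → Fin (suc m)) → Set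
InLMR {n} {m} {e} M ℓ =
  Σ[ F ∈ Factorization n m e ] Σ[ R ∈ Rooting F ] IsPhiL F R M ℓ

lab : ∀ {n m} {f : Fin (suc n) → ℕ} → (Node f → Fin (suc m)) → Node f → ℕ
lab ℓ ν = suc (toℕ (ℓ ν))

module _ {n : ℕ} {f : Fin (suc n) → ℕ} (M : MNTree n f) where
  open MNTree M

  Desc : Fin (suc n) → Fin (suc n) → Set
  Desc v s = ∃[ t ] iter (tpar parent) t v ≡ s

  InMs : Fin (suc n) → Node f → Set
  InMs s μ = Desc (proj₁ μ) s

  Attached : Fin n → (v : Fin (suc n)) → Fin (f v) → Set
  Attached i v k = parent i ≡ v × β i ≡ suc (toℕ k)

  attachedᵇ : (v : Fin (suc n)) → Fin (f v) → Fin (suc n) → Bool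
  attachedᵇ v k zero    = false
  attachedᵇ v k (suc i) = (toℕ (parent i) ≡ᵇ toℕ v) ∧ (β i ≡ᵇ suc (toℕ k))

  InMν : Node f → Node f → Set
  InMν (v , k) μ = μ ≡ (v , k) ⊎ Σ[ i ∈ Fin n ] (Attached i v k × InMs (suc i) μ)

LabelsOf : ∀ {n m} {f : Fin (suc n) → ℕ} → (Node f → Fin (suc m)) → (Node f → Set) → ℕ → Set
LabelsOf ℓ X y = Σ[ μ ∈ _ ] (X μ × lab ℓ μ ≡ y)

IsInterval : (ℕ → Set) → ℕ → ℕ → Set
IsInterval P a b = ∀ y → (P y → a ≤ y × y ≤ b) × (a ≤ y × y ≤ b → P y)

Consec : ℕ → List (ℕ × ℕ) → ℕ → Set
Consec lo []             hi = lo ≡ suc hi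
Consec lo ((a , b) ∷ is) hi = a ≡ lo × a ≤ b × Consec (suc b) is hi

LMRConditions : ∀ {n m} {e : Fin n → ℕ} → MNTree n (vdata e) → (Node (vdata e) → Fin (suc m)) → Set
LMRConditions {n} {m} {e} M ℓ =
  Σ[ αN ∈ (Node (vdata e) → ℕ) ] Σ[ βN ∈ (Node (vdata e) → ℕ) ]
  Σ[ αV ∈ (Fin (suc n) → ℕ) ] Σ[ βV ∈ (Fin (suc n) → ℕ) ]
    ( (∀ ν → 1 ≤ αN ν × αN ν ≤ βN ν × βN ν ≤ suc m)
    × (∀ j → 1 ≤ αV j × αV j ≤ βV j × βV j ≤ suc m)
    × (∀ ν → IsInterval (LabelsOf ℓ (InMν M ν)) (αN ν) (βN ν))
    × (∀ j → IsInterval (LabelsOf ℓ (InMs M j)) (αV j) (βV j))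
    × (∀ j k →
         let att   = filterᵇ (attachedᵇ M j k) (allFin (suc n))
             left  = reverse (filterᵇ (λ w → toℕ w <ᵇ toℕ j) att)
             right = reverse (filterᵇ (λ w → toℕ j <ᵇ toℕ w) att)
             I     = λ w → (αV w , βV w)
         in Consec (αN (j , k))
                   (map I left ++ ((lab ℓ (j , k) , lab ℓ (j , k)) ∷ map I right))
                   (βN (j , k)))
    × (∀ j → Consec (αV j) (map (λ k → (αN (j , k) , βN (j , k))) (allFin (vdata e j))) (βV j)))

-- Read the labels cyclically, 1 coming after d, so that τ adds one to every label.
-- If (M , ℓ) = Φ^L(G) for τ = σ_1 ⋯ σ_{r-1}, then σ_j is the cycle formed by the label of the node
-- that s_j is attached to followed by the labels of the nodes of s_j; so σ_j moves no other label.
-- Consequently τ can leave the label set of a subtree M_s or M_ν only through the factor of its top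
-- vertex, hence at a single label, and a set of labels avoiding 1 which τ leaves only once is an
-- interval: this gives (i) and (ii). Following a label through the partial products σ_1 ⋯ σ_c shows
-- that it visits, in the order of (iii), the intervals of the vertices attached to its node, which
-- gives (iii) and (iv). Conversely, given the intervals, take σ_j to be that cycle: the same
-- induction on c shows that σ_1 ⋯ σ_c sends ℓ μ to the start of the part of μ's sequence in (iii)
-- not traversed yet, which for c = r - 1 is τ (ℓ μ); the tree structure of M gives the rooting.

module Submission where

open import Defs
open import Data.Nat
  using (ℕ; zero; suc; pred; >-nonZero; _+_; _*_; _∸_; _≤_; _<_; _≡ᵇ_; _<ᵇ_;
         z≤n; s≤s; z<s; _<?_; _≤?_)
open import Data.Nat.Properties
open import Data.Nat.DivMod using (_mod_; _%_; m<n⇒m%n≡m; n%n≡0)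
open import Data.Nat.ListAction using (sum)
open import Data.Fin using (Fin; zero; suc; toℕ; fromℕ<; fromℕ; inject₁)
open import Data.Fin.Properties
  using (toℕ-injective; toℕ-fromℕ<; toℕ<n; toℕ-fromℕ; toℕ-inject₁; any?)
  renaming (_≟_ to _≟ᶠ_; suc-injective to Fin-suc-injective)
open import Data.List using (List; []; _∷_; _++_; [_]; map; reverse; filterᵇ; allFin; tabulate)
open import Data.List.Properties
  using (map-++; ++-assoc; ++-identityʳ; reverse-++; unfold-reverse; map-tabulate;
         filter-all; filter-none; filter-idem)
open import Data.List.Membership.Propositional using (_∈_)
open import Data.List.Membership.Propositional.Properties using (∈-filter⁺; ∈-filter⁻; ∈-allFin)
open import Data.List.Relation.Unary.All as All using (All; []; _∷_)
open import Data.List.Relation.Unary.Any using (here; there)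
open import Data.List.Relation.Unary.AllPairs using (AllPairs; []; _∷_)
import Data.List.Relation.Unary.AllPairs.Properties as AllPairs
open import Data.Bool using (Bool; true; false; T)
open import Data.Bool.Properties using (T-≡; ∧-conicalˡ; ∧-conicalʳ)
open import Data.Product using (Σ-syntax; ∃-syntax; _×_; _,_; proj₁; proj₂)
open import Data.Product.Properties using (≡-dec; ,-injectiveˡ)
open import Data.Sum using (_⊎_; inj₁; inj₂)
open import Data.Empty using (⊥; ⊥-elim)
open import Function using (_∘_)
open import Function.Bundles using (Equivalence; _⇔_; mk⇔)
open import Function.Definitions using (Injective; Bijective)
open import Relation.Nullary using (¬_; yes; no; Dec)
open import Relation.Nullary.Decidable using (T?; _×-dec_; _⊎-dec_)
open import Relation.Unary using (Decidable)
open import Relation.Binary.Definitions using (tri<; tri≈; tri>)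
open import Relation.Binary.PropositionalEquality
  using (_≡_; _≢_; refl; sym; trans; cong; cong₂; subst; subst₂; ≢-sym; module ≡-Reasoning)
open ≡-Reasoning

-- Consecutive intervals

Consec-suffix : ∀ {lo hi a b} (A : List (ℕ × ℕ)) {B} →
                Consec lo (A ++ (a , b) ∷ B) hi → Consec (suc b) B hi
Consec-suffix []      (_ , _ , c) = c
Consec-suffix (_ ∷ A) (_ , _ , c) = Consec-suffix A c

Consec-tabulate-lower : ∀ {N lo hi} (g : Fin N → ℕ × ℕ) →
                        Consec lo (tabulate g) hi → ∀ k → lo ≤ proj₁ (g k)
Consec-tabulate-lower g (refl , _ , _) zero = ≤-refl
Consec-tabulate-lower g (refl , a≤b , c) (suc k) =
  ≤-trans a≤b (<⇒≤ (Consec-tabulate-lower (λ k → g (suc k)) c k))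

Consec-tabulate-first : ∀ {N lo hi} (g : Fin N → ℕ × ℕ) (0<N : 0 < N) →
                        Consec lo (tabulate g) hi → proj₁ (g (fromℕ< 0<N)) ≡ lo
Consec-tabulate-first {suc N} g (s≤s z≤n) (eq , _) = eq

Consec-tabulate-next : ∀ {N lo hi} (g : Fin N → ℕ × ℕ) → Consec lo (tabulate g) hi →
                       (k : Fin N) (k+1<N : suc (toℕ k) < N) →
                       proj₁ (g (fromℕ< k+1<N)) ≡ suc (proj₂ (g k))
Consec-tabulate-next {suc (suc N)} g (_ , _ , c) zero    (s≤s (s≤s z≤n)) = proj₁ c
Consec-tabulate-next {suc N}       g (_ , _ , c) (suc k) (s≤s k+1<N)     =
  Consec-tabulate-next (λ k → g (suc k)) c k k+1<N

Consec-tabulate-last : ∀ {N lo hi} (g : Fin N → ℕ × ℕ) → Consec lo (tabulate g) hi →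
                       (k : Fin N) → ¬ (suc (toℕ k) < N) → proj₂ (g k) ≡ hi
Consec-tabulate-last {suc zero}    g (_ , _ , c) zero    _    = suc-injective c
Consec-tabulate-last {suc (suc N)} g _           zero    last = ⊥-elim (last (s≤s (s≤s z≤n)))
Consec-tabulate-last {suc N}       g (_ , _ , c) (suc k) last =
  Consec-tabulate-last (λ k → g (suc k)) c k (λ k+1<N → last (s≤s k+1<N))

Consec-tabulate-sorted : ∀ {N lo hi} (g : Fin N → ℕ × ℕ) → Consec lo (tabulate g) hi →
                         ∀ k k′ → toℕ k < toℕ k′ → proj₂ (g k) < proj₁ (g k′)
Consec-tabulate-sorted g (_ , _ , c) zero    (suc k′) _ = Consec-tabulate-lower (λ k → g (suc k)) c k′
Consec-tabulate-sorted g (_ , _ , c) (suc k) (suc k′) (s≤s k<k′) =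
  Consec-tabulate-sorted (λ k → g (suc k)) c k k′ k<k′

Consec-tabulate⁺ : ∀ {N} (g : Fin N → ℕ × ℕ) lo hi → lo ≤ suc hi →
                   (∀ k → lo ≤ proj₁ (g k) × proj₁ (g k) ≤ proj₂ (g k) × proj₂ (g k) ≤ hi) →
                   (∀ k k′ → toℕ k < toℕ k′ → proj₂ (g k) < proj₁ (g k′)) →
                   (∀ z → lo ≤ z → z ≤ hi → ∃[ k ] (proj₁ (g k) ≤ z × z ≤ proj₂ (g k))) →
                   Consec lo (tabulate g) hi
Consec-tabulate⁺ {zero} g lo hi lo≤hi+1 inside sorted cover with lo ≤? hi
... | yes lo≤hi with () , _ ← cover lo ≤-refl lo≤hi
... | no lo≰hi = ≤-antisym lo≤hi+1 (≰⇒> lo≰hi)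
Consec-tabulate⁺ {suc N} g lo hi _ inside sorted cover =
  first≡lo , a₀≤b₀ ,
  Consec-tabulate⁺ (λ k → g (suc k)) (suc b₀) hi (s≤s b₀≤hi)
    (λ k → sorted zero (suc k) (s≤s z≤n) , proj₂ (inside (suc k)))
    (λ k k′ k<k′ → sorted (suc k) (suc k′) (s≤s k<k′))
    cover⁺
  where
    a₀ = proj₁ (g zero)
    b₀ = proj₂ (g zero)
    lo≤a₀ = proj₁ (inside zero)
    a₀≤b₀ = proj₁ (proj₂ (inside zero))
    b₀≤hi = proj₂ (proj₂ (inside zero))
    first≡lo : a₀ ≡ lo
    first≡lo with cover lo ≤-refl (≤-trans lo≤a₀ (≤-trans a₀≤b₀ b₀≤hi))
    ... | zero  , a₀≤lo , _ = ≤-antisym a₀≤lo lo≤a₀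
    ... | suc k , aₖ≤lo , _ =
      ⊥-elim (<-irrefl refl (<-≤-trans (sorted zero (suc k) (s≤s z≤n))
                                        (≤-trans aₖ≤lo (≤-trans lo≤a₀ a₀≤b₀))))
    cover⁺ : ∀ z → suc b₀ ≤ z → z ≤ hi →
             ∃[ k ] (proj₁ (g (suc k)) ≤ z × z ≤ proj₂ (g (suc k)))
    cover⁺ z b₀<z z≤hi with cover z (≤-trans lo≤a₀ (≤-trans a₀≤b₀ (<⇒≤ b₀<z))) z≤hi
    ... | zero  , _ , z≤b₀ = ⊥-elim (<-irrefl refl (<-≤-trans b₀<z z≤b₀))
    ... | suc k , z∈gₖ     = k , z∈gₖ

disjoint-intervals-ordered : ∀ {a b a′ b′ y y′} →
                             a ≤ y → y ≤ b → a′ ≤ y′ → y′ ≤ b′ → y < y′ →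
                             (∀ z → a ≤ z → z ≤ b → a′ ≤ z → z ≤ b′ → ⊥) → b < a′
disjoint-intervals-ordered {a} {b} {a′} ay yb ay′ yb′ y<y′ disjoint with b <? a′ | a ≤? a′
... | yes b<a′ | _ = b<a′
... | no b≮a′ | yes a≤a′ =
  ⊥-elim (disjoint a′ a≤a′ (≮⇒≥ b≮a′) ≤-refl (≤-trans ay′ yb′))
... | no _    | no a≰a′ =
  ⊥-elim (disjoint a ≤-refl (≤-trans ay yb) (≰⇒≥ a≰a′)
                   (≤-trans ay (≤-trans (<⇒≤ y<y′) yb′)))

Exit : (ℕ → Set) → ℕ → Set
Exit P x = P x × ¬ P (suc x)

module _ {P : ℕ → Set} (P? : Decidable P) where

  private
    minimal-below : ∀ N → (Σ[ a ∈ ℕ ] (P a × ∀ z → z < a → ¬ P z)) ⊎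
                          (∀ z → z < N → ¬ P z)
    minimal-below zero = inj₂ (λ _ ())
    minimal-below (suc N) with minimal-below N | P? N
    ... | inj₁ found | _     = inj₁ found
    ... | inj₂ none  | yes p = inj₁ (N , p , none)
    ... | inj₂ none  | no ¬p = inj₂ none′
      where
        none′ : ∀ z → z < suc N → ¬ P z
        none′ z z<N+1 with m≤n⇒m<n∨m≡n (≤-pred z<N+1)
        ... | inj₁ z<N  = none z z<N
        ... | inj₂ refl = ¬p

  least-element : ∀ y → P y → Σ[ a ∈ ℕ ] (P a × ∀ z → P z → a ≤ z)
  least-element y py with minimal-below (suc y)
  ... | inj₁ (a , pa , minimal) = a , pa , λ z pz → ≮⇒≥ (λ z<a → minimal z z<a pz)
  ... | inj₂ none = ⊥-elim (none y ≤-refl py)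

  climb-to-exit : ∀ d → (∀ z → P z → z ≤ d) → ∀ k y → d ≤ k + y → P y →
                  Σ[ x ∈ ℕ ] (Exit P x × y ≤ x × ∀ z → y ≤ z → z ≤ x → P z)
  climb-to-exit d bound zero y d≤y py =
    y , (py , λ py+1 → <-irrefl refl (≤-trans (bound _ py+1) d≤y)) , ≤-refl ,
    λ z y≤z z≤y → subst P (≤-antisym y≤z z≤y) py
  climb-to-exit d bound (suc k) y d≤ py with P? (suc y)
  ... | no ¬py+1 = y , (py , ¬py+1) , ≤-refl , λ z y≤z z≤y → subst P (≤-antisym y≤z z≤y) py
  ... | yes py+1 with climb-to-exit d bound k (suc y) (subst (d ≤_) (sym (+-suc k y)) d≤) py+1
  ...   | x , exit , y<x , run = x , exit , <⇒≤ y<x , run′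
    where
      run′ : ∀ z → y ≤ z → z ≤ x → P z
      run′ z y≤z z≤x with m≤n⇒m<n∨m≡n y≤z
      ... | inj₁ y<z  = run z y<z z≤x
      ... | inj₂ refl = py

  single-exit⇒interval : ∀ d → (∀ z → P z → z ≤ d) → ∀ y → P y →
                         (∀ x x′ → Exit P x → Exit P x′ → x ≡ x′) →
                         Σ[ a ∈ ℕ ] Σ[ b ∈ ℕ ] (IsInterval P a b × a ≤ b)
  single-exit⇒interval d bound y py exit-unique
    with a , pa , a-least ← least-element y py
    with b , exit-b , a≤b , run ← climb-to-exit d bound d a (m≤m+n d a) pa
    = a , b , (λ z → below-b z , λ (a≤z , z≤b) → run z a≤z z≤b) , a≤b
    where
      below-b : ∀ z → P z → a ≤ z × z ≤ b
      below-b z pz with x , exit-x , z≤x , _ ← climb-to-exit d bound d z (m≤m+n d z) pz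
        = a-least z pz , subst (z ≤_) (exit-unique x b exit-x exit-b) z≤x

<⇒<ᵇ≡true : ∀ {m n} → m < n → (m <ᵇ n) ≡ true
<⇒<ᵇ≡true m<n = Equivalence.to T-≡ (<⇒<ᵇ m<n)

<ᵇ≡true⇒< : ∀ m n → (m <ᵇ n) ≡ true → m < n
<ᵇ≡true⇒< m n eq = <ᵇ⇒< m n (Equivalence.from T-≡ eq)

≥⇒<ᵇ≡false : ∀ {m n} → n ≤ m → (m <ᵇ n) ≡ false
≥⇒<ᵇ≡false {m}     {zero}  _         = refl
≥⇒<ᵇ≡false {suc m} {suc n} (s≤s n≤m) = ≥⇒<ᵇ≡false n≤m

≡⇒≡ᵇ≡true : ∀ {m n} → m ≡ n → (m ≡ᵇ n) ≡ true
≡⇒≡ᵇ≡true {m} m≡n = Equivalence.to T-≡ (≡⇒≡ᵇ m _ m≡n)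

≡ᵇ≡true⇒≡ : ∀ m n → (m ≡ᵇ n) ≡ true → m ≡ n
≡ᵇ≡true⇒≡ m n eq = ≡ᵇ⇒≡ m n (Equivalence.from T-≡ eq)

≢⇒≡ᵇ≡false : ∀ {m n} → m ≢ n → (m ≡ᵇ n) ≡ false
≢⇒≡ᵇ≡false {m} {n} m≢n with m ≡ᵇ n in eq
... | false = refl
... | true  = ⊥-elim (m≢n (≡ᵇ≡true⇒≡ m n eq))

module _ {A : Set} where

  filterᵇ-all : (p : A → Bool) {xs : List A} → All (λ x → p x ≡ true) xs → filterᵇ p xs ≡ xs
  filterᵇ-all p all = filter-all (T? ∘ p) (All.map (Equivalence.from T-≡) all)

  filterᵇ-none : (p : A → Bool) {xs : List A} → All (λ x → p x ≡ false) xs → filterᵇ p xs ≡ []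
  filterᵇ-none p none = filter-none (T? ∘ p) (All.map (λ px≡false → subst T px≡false) none)

  filterᵇ-redundant : (p q : A → Bool) → (∀ x → q x ≡ true → p x ≡ true) → ∀ xs →
                      filterᵇ p (filterᵇ q xs) ≡ filterᵇ q xs
  filterᵇ-redundant p q q⇒p [] = refl
  filterᵇ-redundant p q q⇒p (x ∷ xs) with q x in qx
  ... | false = filterᵇ-redundant p q q⇒p xs
  ... | true rewrite q⇒p x qx = cong (x ∷_) (filterᵇ-redundant p q q⇒p xs)

module _ {N : ℕ} where

  below above at : ℕ → Fin N → Bool
  below k u = toℕ u <ᵇ k
  above k u = k <ᵇ toℕ u
  at    k u = toℕ u ≡ᵇ k

  Sorted : List (Fin N) → Set
  Sorted = AllPairs (λ u v → toℕ u < toℕ v)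

  allFin-sorted : Sorted (allFin N)
  allFin-sorted = AllPairs.tabulate⁺-< (λ i<j → i<j)

  filterᵇ-sorted : (p : Fin N → Bool) {xs : List (Fin N)} → Sorted xs → Sorted (filterᵇ p xs)
  filterᵇ-sorted p = AllPairs.filter⁺ (T? ∘ p)

  private
    none-below : ∀ k {xs} → All (λ u → k ≤ toℕ u) xs → filterᵇ (below k) xs ≡ []
    none-below k = filterᵇ-none (below k) ∘ All.map ≥⇒<ᵇ≡false

    none-at : ∀ k {xs} → All (λ u → k < toℕ u) xs → filterᵇ (at k) xs ≡ []
    none-at k = filterᵇ-none (at k) ∘ All.map (λ k<u → ≢⇒≡ᵇ≡false (≢-sym (<⇒≢ k<u)))

    all-above : ∀ k {xs} → All (λ u → k < toℕ u) xs → filterᵇ (above k) xs ≡ xs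
    all-above k = filterᵇ-all (above k) ∘ All.map <⇒<ᵇ≡true

  filterᵇ-below-suc : ∀ k xs → Sorted xs →
                      filterᵇ (below (suc k)) xs ≡ filterᵇ (below k) xs ++ filterᵇ (at k) xs
  filterᵇ-below-suc k [] _ = refl
  filterᵇ-below-suc k (x ∷ xs) (x<xs ∷ sorted) with <-cmp (toℕ x) k
  ... | tri< x<k _ _
    rewrite <⇒<ᵇ≡true (m<n⇒m<1+n x<k) | <⇒<ᵇ≡true x<k | ≢⇒≡ᵇ≡false (<⇒≢ x<k)
    = cong (x ∷_) (filterᵇ-below-suc k xs sorted)
  ... | tri≈ _ refl _
    rewrite <⇒<ᵇ≡true (n<1+n (toℕ x)) | ≥⇒<ᵇ≡false (≤-refl {toℕ x})
          | ≡⇒≡ᵇ≡true (refl {x = toℕ x})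
          | none-below (suc (toℕ x)) x<xs | none-below (toℕ x) (All.map <⇒≤ x<xs)
          | none-at (toℕ x) x<xs
    = refl
  ... | tri> _ _ k<x
    rewrite ≥⇒<ᵇ≡false k<x | ≥⇒<ᵇ≡false (<⇒≤ k<x)
          | ≢⇒≡ᵇ≡false (≢-sym (<⇒≢ k<x))
          | none-below (suc k) (All.map (<-trans k<x) x<xs)
          | none-below k (All.map (<⇒≤ ∘ <-trans k<x) x<xs)
          | none-at k (All.map (<-trans k<x) x<xs)
    = refl

  filterᵇ-at-∈ : ∀ w xs → Sorted xs → w ∈ xs → filterᵇ (at (toℕ w)) xs ≡ [ w ]
  filterᵇ-at-∈ w (.w ∷ xs) (w<xs ∷ _) (here refl)
    rewrite ≡⇒≡ᵇ≡true (refl {x = toℕ w}) | none-at (toℕ w) w<xs = refl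
  filterᵇ-at-∈ w (x ∷ xs) (x<xs ∷ sorted) (there w∈xs)
    rewrite ≢⇒≡ᵇ≡false (<⇒≢ (All.lookup x<xs w∈xs)) = filterᵇ-at-∈ w xs sorted w∈xs

  filterᵇ-at-∉ : ∀ w xs → ¬ w ∈ xs → filterᵇ (at (toℕ w)) xs ≡ []
  filterᵇ-at-∉ w [] _ = refl
  filterᵇ-at-∉ w (x ∷ xs) w∉ with toℕ x ≡ᵇ toℕ w in eq
  ... | false = filterᵇ-at-∉ w xs (w∉ ∘ there)
  ... | true  = ⊥-elim (w∉ (here (toℕ-injective (sym (≡ᵇ≡true⇒≡ _ _ eq)))))

  sorted-split : ∀ w xs → Sorted xs → w ∈ xs →
                 xs ≡ filterᵇ (below (toℕ w)) xs ++ w ∷ filterᵇ (above (toℕ w)) xs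
  sorted-split w (.w ∷ xs) (w<xs ∷ _) (here refl)
    rewrite ≥⇒<ᵇ≡false (≤-refl {toℕ w}) | none-below (toℕ w) (All.map <⇒≤ w<xs)
          | all-above (toℕ w) w<xs
    = refl
  sorted-split w (x ∷ xs) (x<xs ∷ sorted) (there w∈xs)
    rewrite <⇒<ᵇ≡true (All.lookup x<xs w∈xs) | ≥⇒<ᵇ≡false (<⇒≤ (All.lookup x<xs w∈xs))
    = cong (x ∷_) (sorted-split w xs sorted w∈xs)

  reverse-split : ∀ {k} w xs → toℕ w ≡ k → Sorted xs → w ∈ xs →
                  reverse xs ≡ reverse (filterᵇ (above k) xs) ++ w ∷ reverse (filterᵇ (below k) xs)
  reverse-split w xs refl sorted w∈xs = begin
      reverse xs
    ≡⟨ cong reverse (sorted-split w xs sorted w∈xs) ⟩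
      reverse (L ++ w ∷ R)
    ≡⟨ reverse-++ L (w ∷ R) ⟩
      reverse (w ∷ R) ++ reverse L
    ≡⟨ cong (_++ reverse L) (unfold-reverse w R) ⟩
      (reverse R ++ [ w ]) ++ reverse L
    ≡⟨ ++-assoc (reverse R) [ w ] (reverse L) ⟩
      reverse R ++ w ∷ reverse L
    ∎
    where
      L = filterᵇ (below (toℕ w)) xs
      R = filterᵇ (above (toℕ w)) xs

  reverse-filterᵇ-below-suc-∈ : ∀ {k} w xs → toℕ w ≡ k → Sorted xs → w ∈ xs →
    reverse (filterᵇ (below (suc k)) xs) ≡ w ∷ reverse (filterᵇ (below k) xs)
  reverse-filterᵇ-below-suc-∈ w xs refl sorted w∈xs
    rewrite filterᵇ-below-suc (toℕ w) xs sorted | filterᵇ-at-∈ w xs sorted w∈xs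
    = reverse-++ (filterᵇ (below (toℕ w)) xs) [ w ]

  reverse-filterᵇ-below-suc-∉ : ∀ {k} w xs → toℕ w ≡ k → Sorted xs → ¬ w ∈ xs →
    reverse (filterᵇ (below (suc k)) xs) ≡ reverse (filterᵇ (below k) xs)
  reverse-filterᵇ-below-suc-∉ w xs refl sorted w∉xs
    rewrite filterᵇ-below-suc (toℕ w) xs sorted | filterᵇ-at-∉ w xs w∉xs
    = cong reverse (++-identityʳ (filterᵇ (below (toℕ w)) xs))

  filterᵇ-below-above : ∀ k xs → filterᵇ (below (suc k)) (filterᵇ (above k) xs) ≡ []
  filterᵇ-below-above k [] = refl
  filterᵇ-below-above k (x ∷ xs) with k <ᵇ toℕ x in eq
  ... | false = filterᵇ-below-above k xs
  ... | true rewrite ≥⇒<ᵇ≡false {toℕ x} {suc k} (<ᵇ≡true⇒< k (toℕ x) eq) =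
    filterᵇ-below-above k xs

-- Partial products of a sequence of permutations

iter-suc : ∀ {A : Set} (f : A → A) t x → iter f (suc t) x ≡ iter f t (f x)
iter-suc f zero    x = refl
iter-suc f (suc t) x = cong f (iter-suc f t x)

iter-+ : ∀ {A : Set} (f : A → A) a b x → iter f (a + b) x ≡ iter f a (iter f b x)
iter-+ f zero    b x = refl
iter-+ f (suc a) b x = cong f (iter-+ f a b x)

module _ {A : Set} {n : ℕ} (σ : Fin n → A → A) where

  factor : ℕ → A → A
  factor k with k <? n
  ... | yes k<n = σ (fromℕ< k<n)
  ... | no  _   = λ x → x

  factor-< : ∀ {k} (k<n : k < n) x → factor k x ≡ σ (fromℕ< k<n) x
  factor-< {k} k<n x with k <? n
  ... | yes k<n′ = cong (λ p → σ (fromℕ< p) x) (<-irrelevant k<n′ k<n)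
  ... | no  k≮n  = ⊥-elim (k≮n k<n)

  factor-≥ : ∀ {k} → n ≤ k → ∀ x → factor k x ≡ x
  factor-≥ {k} n≤k x with k <? n
  ... | yes k<n = ⊥-elim (<⇒≱ k<n n≤k)
  ... | no  _   = refl

  factor-toℕ : ∀ i x → factor (toℕ i) x ≡ σ i x
  factor-toℕ i x =
    trans (factor-< (toℕ<n i) x) (cong (λ j → σ j x) (toℕ-injective (toℕ-fromℕ< _)))

  -- segment a l = factor a ∘ ⋯ ∘ factor (a + l - 1), where factor k = σ k for k < n.
  segment : ℕ → ℕ → A → A
  segment a zero    x = x
  segment a (suc l) x = segment a l (factor (a + l) x)

  segment-+ : ∀ a l₁ l₂ x → segment a (l₁ + l₂) x ≡ segment a l₁ (segment (a + l₁) l₂ x)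
  segment-+ a l₁ zero x = cong (λ l → segment a l x) (+-identityʳ l₁)
  segment-+ a l₁ (suc l₂) x = begin
      segment a (l₁ + suc l₂) x
    ≡⟨ cong (λ l → segment a l x) (+-suc l₁ l₂) ⟩
      segment a (l₁ + l₂) (factor (a + (l₁ + l₂)) x)
    ≡⟨ segment-+ a l₁ l₂ _ ⟩
      segment a l₁ (segment (a + l₁) l₂ (factor (a + (l₁ + l₂)) x))
    ≡⟨ cong (λ k → segment a l₁ (segment (a + l₁) l₂ (factor k x))) (sym (+-assoc a l₁ l₂)) ⟩
      segment a l₁ (segment (a + l₁) (suc l₂) x)
    ∎

  segment-injective : (∀ i → Injective _≡_ _≡_ (σ i)) →
                      ∀ a l → Injective _≡_ _≡_ (segment a l)
  segment-injective σ-inj a zero    eq = eq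
  segment-injective σ-inj a (suc l) eq = factor-injective (a + l) (segment-injective σ-inj a l eq)
    where
      factor-injective : ∀ k → Injective _≡_ _≡_ (factor k)
      factor-injective k with k <? n
      ... | yes k<n = σ-inj (fromℕ< k<n)
      ... | no  _   = λ eq → eq

  segment-preserves : (P : A → Set) → ∀ a l →
                      (∀ k → a ≤ k → k < a + l → ∀ x → P x → P (factor k x)) →
                      ∀ x → P x → P (segment a l x)
  segment-preserves P a zero    _     x px = px
  segment-preserves P a (suc l) pres x px =
    segment-preserves P a l (λ k a≤k k<a+l → pres k a≤k (≤-trans k<a+l (+-monoʳ-≤ a (n≤1+n l)))) _
      (pres (a + l) (m≤m+n a l) (+-monoʳ-< a ≤-refl) x px)

segment-suc-start : ∀ {A : Set} {n} (σ : Fin (suc n) → A → A) a l x →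
                    segment σ (suc a) l x ≡ segment (σ ∘ suc) a l x
segment-suc-start {n = n} σ a zero    x = refl
segment-suc-start {n = n} σ a (suc l) x =
  trans (cong (segment σ (suc a) l) (factor-suc (a + l))) (segment-suc-start σ a l _)
  where
    factor-suc : ∀ k → factor σ (suc k) x ≡ factor (σ ∘ suc) k x
    factor-suc k = by-cases (k <? n)
      where
        by-cases : Dec (k < n) → factor σ (suc k) x ≡ factor (σ ∘ suc) k x
        by-cases (yes k<n) =
          trans (factor-< σ (s≤s k<n) x) (sym (factor-< (σ ∘ suc) k<n x))
        by-cases (no  k≮n) =
          trans (factor-≥ σ (s≤s (≮⇒≥ k≮n)) x) (sym (factor-≥ (σ ∘ suc) (≮⇒≥ k≮n) x))

prod≡segment : ∀ {A : Set} {n} (σ : Fin n → A → A) x → prod σ x ≡ segment σ 0 n x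
prod≡segment {n = zero}  σ x = refl
prod≡segment {n = suc n} σ x = begin
    σ zero (prod (σ ∘ suc) x)
  ≡⟨ cong (σ zero) (prod≡segment (σ ∘ suc) x) ⟩
    σ zero (segment (σ ∘ suc) 0 n x)
  ≡⟨ cong (σ zero) (sym (segment-suc-start σ 0 n x)) ⟩
    σ zero (segment σ 1 n x)
  ≡⟨ sym (factor-< σ (s≤s z≤n) _) ⟩
    segment σ 0 1 (segment σ 1 n x)
  ≡⟨ sym (segment-+ σ 0 1 n x) ⟩
    segment σ 0 (suc n) x
  ∎

prod-split : ∀ {A : Set} {n} (σ : Fin n → A → A) k → k ≤ n → ∀ x →
             prod σ x ≡ segment σ 0 k (segment σ k (n ∸ k) x)
prod-split {n = n} σ k k≤n x =
  trans (prod≡segment σ x)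
        (trans (cong (λ l → segment σ 0 l x) (sym (m+[n∸m]≡n k≤n))) (segment-+ σ 0 k (n ∸ k) x))

module Factorisation {A : Set} {n : ℕ} (σ : Fin n → A → A) (π : A → A)
                     (prod≗π : ∀ x → prod σ x ≡ π x)
                     (σ-inj : ∀ i → Injective _≡_ _≡_ (σ i)) where

  prefix : ℕ → A → A
  prefix = segment σ 0

  prefix-suc : ∀ i x → prefix (suc (toℕ i)) x ≡ prefix (toℕ i) (σ i x)
  prefix-suc i x = cong (prefix (toℕ i)) (factor-toℕ σ i x)

  suffix : ℕ → A → A
  suffix c = segment σ c (n ∸ c)

  after : Fin n → A → A
  after i = suffix (suc (toℕ i))

  after-injective : ∀ i → Injective _≡_ _≡_ (after i)
  after-injective i = segment-injective σ σ-inj (suc (toℕ i)) (n ∸ suc (toℕ i))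

  π≡prefix∘σ∘after : ∀ i x → π x ≡ prefix (toℕ i) (σ i (after i x))
  π≡prefix∘σ∘after i x =
    trans (sym (prod≗π x)) (trans (prod-split σ (suc (toℕ i)) (toℕ<n i) x) (prefix-suc i (after i x)))

  suffix-toℕ : ∀ i x → suffix (toℕ i) x ≡ σ i (after i x)
  suffix-toℕ i x = begin
      suffix (toℕ i) x
    ≡⟨ cong (λ l → segment σ (toℕ i) l x) (+-∸-assoc 1 (toℕ<n i)) ⟩
      segment σ (toℕ i) (1 + (n ∸ suc (toℕ i))) x
    ≡⟨ segment-+ σ (toℕ i) 1 (n ∸ suc (toℕ i)) x ⟩
      factor σ (toℕ i + 0) (segment σ (toℕ i + 1) (n ∸ suc (toℕ i)) x)
    ≡⟨ cong₂ (λ a b → factor σ a (segment σ b (n ∸ suc (toℕ i)) x))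
             (+-identityʳ (toℕ i)) (+-comm (toℕ i) 1) ⟩
      factor σ (toℕ i) (after i x)
    ≡⟨ factor-toℕ σ i (after i x) ⟩
      σ i (after i x)
    ∎

  π≡prefix⇒suffix≡ : ∀ c → c ≤ n → ∀ z p → π z ≡ prefix c p → suffix c z ≡ p
  π≡prefix⇒suffix≡ c c≤n z p πz≡ =
    segment-injective σ σ-inj 0 c (trans (sym (prod-split σ c c≤n z)) (trans (prod≗π z) πz≡))

  PreservedExcept : (A → Set) → Fin n → Set
  PreservedExcept P i = ∀ t → t ≢ i → ∀ x → P x → P (σ t x)

  module _ {P : A → Set} {i : Fin n} (pres : PreservedExcept P i) where

    private
      factor-preserves : ∀ k → k ≢ toℕ i → ∀ x → P x → P (factor σ k x)
      factor-preserves k k≢i x px with k <? n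
      ... | yes k<n =
        pres (fromℕ< k<n) (λ eq → k≢i (trans (sym (toℕ-fromℕ< k<n)) (cong toℕ eq))) x px
      ... | no  _   = px

    prefix-preserves : ∀ x → P x → P (prefix (toℕ i) x)
    prefix-preserves = segment-preserves σ P 0 (toℕ i) (λ k _ k<i → factor-preserves k (<⇒≢ k<i))

    after-preserves : ∀ x → P x → P (after i x)
    after-preserves =
      segment-preserves σ P (suc (toℕ i)) (n ∸ suc (toℕ i))
        (λ k i<k _ → factor-preserves k (≢-sym (<⇒≢ i<k)))

    exit-through : ∀ x → P x → ¬ P (π x) → P (after i x) × ¬ P (σ i (after i x))
    exit-through x px ¬pπx =
      after-preserves x px ,
      λ p → ¬pπx (subst P (sym (π≡prefix∘σ∘after i x)) (prefix-preserves _ p))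

cycle-injective : ∀ {d e} {σ : Fin d → Fin d} → IsCycle e σ → Injective _≡_ _≡_ σ
cycle-injective {d} {e} {σ} (c , c-inj , c-step , c-fixed) {x} {y} σx≡σy =
  by-cases (any? (λ k → c k ≟ᶠ x)) (any? (λ k → c k ≟ᶠ y))
  where
    Next : Fin e → Fin e → Set
    Next k j = toℕ j ≡ suc (toℕ k) ⊎ (toℕ j ≡ 0 × suc (toℕ k) ≡ e)

    next : ∀ k → ∃[ j ] Next k j
    next k with suc (toℕ k) <? e
    ... | yes k+1<e = fromℕ< k+1<e , inj₁ (toℕ-fromℕ< k+1<e)
    ... | no  k+1≮e = fromℕ< (≤-trans (s≤s z≤n) (toℕ<n k)) ,
                      inj₂ (toℕ-fromℕ< _ , ≤-antisym (toℕ<n k) (≮⇒≥ k+1≮e))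

    Next-injective : ∀ {k k′ j} → Next k j → Next k′ j → k ≡ k′
    Next-injective (inj₁ j≡k+1) (inj₁ j≡k′+1) =
      toℕ-injective (suc-injective (trans (sym j≡k+1) j≡k′+1))
    Next-injective (inj₁ j≡k+1) (inj₂ (j≡0 , _)) = ⊥-elim (1+n≢0 (trans (sym j≡k+1) j≡0))
    Next-injective (inj₂ (j≡0 , _)) (inj₁ j≡k′+1) = ⊥-elim (1+n≢0 (trans (sym j≡k′+1) j≡0))
    Next-injective (inj₂ (_ , k+1≡e)) (inj₂ (_ , k′+1≡e)) =
      toℕ-injective (suc-injective (trans k+1≡e (sym k′+1≡e)))

    σ-on-cycle : ∀ k → σ (c k) ≡ c (proj₁ (next k))
    σ-on-cycle k = c-step k _ (proj₂ (next k))

    σ-off-cycle : ∀ {z} → ¬ (∃[ k ] c k ≡ z) → σ z ≡ z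
    σ-off-cycle z∉c = c-fixed _ (λ k ck≡z → z∉c (k , ck≡z))

    by-cases : Dec (∃[ k ] c k ≡ x) → Dec (∃[ k ] c k ≡ y) → x ≡ y
    by-cases (yes (k , refl)) (yes (k′ , refl)) =
      cong c (Next-injective (proj₂ (next k))
                             (subst (Next k′) (sym next-k≡next-k′) (proj₂ (next k′))))
      where next-k≡next-k′ = c-inj (trans (sym (σ-on-cycle k)) (trans σx≡σy (σ-on-cycle k′)))
    by-cases (yes (k , refl)) (no y∉c) =
      ⊥-elim (y∉c (_ , trans (sym (σ-on-cycle k)) (trans σx≡σy (σ-off-cycle y∉c))))
    by-cases (no x∉c) (yes (k′ , refl)) =
      ⊥-elim (x∉c (_ , trans (sym (σ-on-cycle k′)) (trans (sym σx≡σy) (σ-off-cycle x∉c))))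
    by-cases (no x∉c) (no y∉c) = trans (sym (σ-off-cycle x∉c)) (trans σx≡σy (σ-off-cycle y∉c))

module _ {m : ℕ} where

  tau-< : (x : Fin (suc m)) → toℕ x < m → toℕ (tau m x) ≡ suc (toℕ x)
  tau-< x x<m = trans (toℕ-fromℕ< _) (m<n⇒m%n≡m (s≤s x<m))

  tau-last : (x : Fin (suc m)) → toℕ x ≡ m → tau m x ≡ zero
  tau-last x x≡m = toℕ-injective
    (trans (toℕ-fromℕ< _) (subst (λ k → suc k % suc m ≡ 0) (sym x≡m) (n%n≡0 (suc m))))

  tau-cases : (x : Fin (suc m)) →
              (toℕ x < m × toℕ (tau m x) ≡ suc (toℕ x)) ⊎ (toℕ x ≡ m × tau m x ≡ zero)
  tau-cases x with toℕ x <? m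
  ... | yes x<m = inj₁ (x<m , tau-< x x<m)
  ... | no  x≮m = inj₂ (x≡m , tau-last x x≡m)
    where x≡m = ≤-antisym (≤-pred (toℕ<n x)) (≮⇒≥ x≮m)

  tau-≢zero : (x : Fin (suc m)) → tau m x ≢ zero → toℕ (tau m x) ≡ suc (toℕ x)
  tau-≢zero x τx≢0 with tau-cases x
  ... | inj₁ (_ , τx≡x+1) = τx≡x+1
  ... | inj₂ (_ , τx≡0)   = ⊥-elim (τx≢0 τx≡0)

  tau⁻¹ : Fin (suc m) → Fin (suc m)
  tau⁻¹ zero    = fromℕ m
  tau⁻¹ (suc y) = inject₁ y

  tau-tau⁻¹ : (y : Fin (suc m)) → tau m (tau⁻¹ y) ≡ y
  tau-tau⁻¹ zero    = tau-last (fromℕ m) (toℕ-fromℕ m)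
  tau-tau⁻¹ (suc y) = toℕ-injective
    (trans (tau-< (inject₁ y) (subst (_< m) (sym (toℕ-inject₁ y)) (toℕ<n y)))
           (cong suc (toℕ-inject₁ y)))

  -- The label toℕ x + 1 of x, except that 1 is read as d + 1 (the label after d along τ).
  label⁺ : Fin (suc m) → ℕ
  label⁺ zero    = suc (suc m)
  label⁺ (suc y) = suc (suc (toℕ y))

  label⁺-≢zero : (x : Fin (suc m)) → x ≢ zero → label⁺ x ≡ suc (toℕ x)
  label⁺-≢zero zero    x≢0 = ⊥-elim (x≢0 refl)
  label⁺-≢zero (suc y) _   = refl

  label⁺-tau : (x : Fin (suc m)) → label⁺ (tau m x) ≡ suc (suc (toℕ x))
  label⁺-tau x with tau-cases x
  ... | inj₁ (_ , τx≡x+1) =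
    trans (label⁺-≢zero (tau m x) (λ τx≡0 → 1+n≢0 (trans (sym τx≡x+1) (cong toℕ τx≡0))))
          (cong suc τx≡x+1)
  ... | inj₂ (x≡m , τx≡0) = trans (cong label⁺ τx≡0) (cong (λ k → suc (suc k)) (sym x≡m))

  fromLabel⁺ : ℕ → Fin (suc m)
  fromLabel⁺ s = pred s mod suc m

  fromLabel⁺-label : (x : Fin (suc m)) → fromLabel⁺ (suc (toℕ x)) ≡ x
  fromLabel⁺-label x = toℕ-injective (trans (toℕ-fromℕ< _) (m<n⇒m%n≡m (toℕ<n x)))

  fromLabel⁺-top : fromLabel⁺ (suc (suc m)) ≡ zero
  fromLabel⁺-top = toℕ-injective (trans (toℕ-fromℕ< _) (n%n≡0 (suc m)))

module Tree {n : ℕ} {f : Fin (suc n) → ℕ} (M : MNTree n f) where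
  open MNTree M

  private
    up : Fin (suc n) → Fin (suc n)
    up = tpar parent

    iter-up-root : ∀ t → iter up t zero ≡ zero
    iter-up-root zero    = refl
    iter-up-root (suc t) = cong up (iter-up-root t)

    iter-up-beyond : ∀ {v d t} → iter up d v ≡ zero → d ≤ t → iter up t v ≡ zero
    iter-up-beyond {v} {d} {t} reaches-root d≤t =
      trans (cong (λ z → iter up z v) (sym (m∸n+n≡m d≤t)))
            (trans (iter-+ up (t ∸ d) d v)
                   (trans (cong (iter up (t ∸ d)) reaches-root) (iter-up-root (t ∸ d))))

  Desc-refl : ∀ v → Desc M v v
  Desc-refl v = 0 , refl

  Desc-step : ∀ v {s} → Desc M (tpar parent v) s → Desc M v s
  Desc-step v (t , e) = suc t , trans (iter-suc up t v) e

  Desc-up : ∀ v {s} → Desc M v s → v ≢ s → Desc M (tpar parent v) s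
  Desc-up v (zero  , e) v≢s = ⊥-elim (v≢s e)
  Desc-up v (suc t , e) _   = t , trans (sym (iter-suc up t v)) e

  Desc-trans : ∀ {u v w} → Desc M u v → Desc M v w → Desc M u w
  Desc-trans {u} (a , e₁) (b , e₂) = b + a , trans (iter-+ up b a u) (trans (cong (iter up b) e₁) e₂)

  ¬Desc-root : ∀ {i} → ¬ Desc M zero (suc i)
  ¬Desc-root (t , e) with () ← trans (sym (iter-up-root t)) e

  -- A cycle through suc i would make its iterated parents periodic, yet they reach the root.
  ¬Desc-parent : ∀ i → ¬ Desc M (parent i) (suc i)
  ¬Desc-parent i (k , e) = root≢suc (trans (sym at-root) (periodic depth))
    where
      depth = proj₁ (rooted (suc i))
      root≢suc : zero ≢ suc i
      root≢suc ()
      periodic : ∀ j → iter up (j * suc k) (suc i) ≡ suc i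
      periodic zero    = refl
      periodic (suc j) = trans (iter-+ up (suc k) (j * suc k) (suc i))
                               (trans (cong (iter up (suc k)) (periodic j)) (trans (iter-suc up k (suc i)) e))
      at-root : iter up (depth * suc k) (suc i) ≡ zero
      at-root = iter-up-beyond (proj₂ (rooted (suc i))) (m≤m*n depth (suc k))

  private
    Desc-along : ∀ {u a b k₁ k₂} → k₁ ≤ k₂ → iter up k₁ u ≡ a → iter up k₂ u ≡ b →
                 Desc M a b
    Desc-along {u} {k₁ = k₁} {k₂} k₁≤k₂ refl e₂ =
      k₂ ∸ k₁ , trans (sym (iter-+ up (k₂ ∸ k₁) k₁ u))
                      (trans (cong (λ t → iter up t u) (m∸n+n≡m k₁≤k₂)) e₂)

  Desc-comparable : ∀ {u a b} → Desc M u a → Desc M u b → Desc M a b ⊎ Desc M b a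
  Desc-comparable (k₁ , e₁) (k₂ , e₂) with ≤-total k₁ k₂
  ... | inj₁ k₁≤k₂ = inj₁ (Desc-along k₁≤k₂ e₁ e₂)
  ... | inj₂ k₂≤k₁ = inj₂ (Desc-along k₂≤k₁ e₂ e₁)

  ¬Desc-siblings : ∀ {v t t′} → parent t ≡ parent t′ → t ≢ t′ →
                   Desc M v (suc t) → Desc M v (suc t′) → ⊥
  ¬Desc-siblings {t = t} {t′} same t≢t′ d d′ with Desc-comparable d d′
  ... | inj₁ t≤t′ = ¬Desc-parent t′ (subst (λ z → Desc M z (suc t′)) same
                                           (Desc-up (suc t) t≤t′ (t≢t′ ∘ Fin-suc-injective)))
  ... | inj₂ t′≤t = ¬Desc-parent t (subst (λ z → Desc M z (suc t)) (sym same)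
                                          (Desc-up (suc t′) t′≤t (t≢t′ ∘ sym ∘ Fin-suc-injective)))

  Desc-child : ∀ {v s} → Desc M v s → v ≢ s → Σ[ t ∈ Fin n ] (parent t ≡ s × Desc M v (suc t))
  Desc-child {v} {s} (k , e) v≢s = go k v e v≢s
    where
      go : ∀ k v → iter up k v ≡ s → v ≢ s → Σ[ t ∈ Fin n ] (parent t ≡ s × Desc M v (suc t))
      go zero    v       e v≢s = ⊥-elim (v≢s e)
      go (suc k) v       e v≢s with up v ≟ᶠ s
      go (suc k) zero    e v≢s | yes up-v≡s = ⊥-elim (v≢s up-v≡s)
      go (suc k) (suc i) e v≢s | yes up-v≡s = i , up-v≡s , Desc-refl (suc i)
      go (suc k) v       e v≢s | no up-v≢s
        with t , pt≡s , d ← go k (up v) (trans (sym (iter-suc up k v)) e) up-v≢s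
        = t , pt≡s , Desc-step v d

  Desc? : ∀ v s → Dec (Desc M v s)
  Desc? v zero = yes (rooted v)
  Desc? v (suc i) with depth , reaches-root ← rooted v
                  with any? {n = depth} (λ j → iter up (toℕ j) v ≟ᶠ suc i)
  ... | yes (j , e) = yes (toℕ j , e)
  ... | no  none    = no λ (t , e) → never t e
    where
      never : ∀ t → iter up t v ≢ suc i
      never t e with t <? depth
      ... | yes t<depth = none (fromℕ< t<depth , trans (cong (λ z → iter up z v) (toℕ-fromℕ< t<depth)) e)
      ... | no  t≮depth with () ← trans (sym (iter-up-beyond reaches-root (≮⇒≥ t≮depth))) e

  Node≟ : (μ μ′ : Node f) → Dec (μ ≡ μ′)
  Node≟ = ≡-dec _≟ᶠ_ _≟ᶠ_

  InMs? : ∀ s μ → Dec (InMs M s μ)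
  InMs? s μ = Desc? (proj₁ μ) s

  Attached? : ∀ i v (k : Fin (f v)) → Dec (Attached M i v k)
  Attached? i v k = (parent i ≟ᶠ v) ×-dec (β i ≟ suc (toℕ k))

  InMν? : ∀ ν μ → Dec (InMν M ν μ)
  InMν? (v , k) μ = Node≟ μ (v , k) ⊎-dec any? (λ i → Attached? i v k ×-dec InMs? (suc i) μ)

  attachment : Fin n → Node f
  attachment i = parent i , fromℕ< (pred< (proj₁ (β-range i)) (proj₂ (β-range i)))
    where
      pred< : ∀ {b c} → 1 ≤ b → b ≤ c → pred b < c
      pred< {suc b} _ b+1≤c = b+1≤c

  attachment-β : ∀ i → suc (toℕ (proj₂ (attachment i))) ≡ β i
  attachment-β i = trans (cong suc (toℕ-fromℕ< _)) (suc-pred (β i) {{>-nonZero (proj₁ (β-range i))}})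

  Attached⇒≡attachment : ∀ {i v k} → Attached M i v k → attachment i ≡ (v , k)
  Attached⇒≡attachment {i} (refl , β≡k+1) =
    cong (parent i ,_) (toℕ-injective (suc-injective (trans (attachment-β i) β≡k+1)))

  ≡attachment⇒Attached : ∀ {i v k} → attachment i ≡ (v , k) → Attached M i v k
  ≡attachment⇒Attached {i} refl = refl , sym (attachment-β i)

  attached-to-parent : ∀ {t v} → parent t ≡ v → Σ[ k ∈ Fin (f v) ] Attached M t v k
  attached-to-parent {t} refl = proj₂ (attachment t) , ≡attachment⇒Attached refl

  attachedᵇ⇒Attached : ∀ {v k i} → attachedᵇ M v k (suc i) ≡ true → Attached M i v k
  attachedᵇ⇒Attached {v} {k} {i} eq =
    toℕ-injective (≡ᵇ≡true⇒≡ _ _ (∧-conicalˡ _ _ eq)) ,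
    ≡ᵇ≡true⇒≡ _ _ (∧-conicalʳ _ _ eq)

  Attached⇒attachedᵇ : ∀ {v k i} → Attached M i v k → attachedᵇ M v k (suc i) ≡ true
  Attached⇒attachedᵇ {i = i} (refl , β≡k+1)
    rewrite ≡⇒≡ᵇ≡true (refl {x = toℕ (parent i)}) | ≡⇒≡ᵇ≡true β≡k+1 = refl

  parent≢self : ∀ i → parent i ≢ suc i
  parent≢self i eq = ¬Desc-parent i (subst (λ z → Desc M z (suc i)) (sym eq) (Desc-refl (suc i)))

  Node-index-injective : ∀ {v} {k k′ : Fin (f v)} → _≡_ {A = Node f} (v , k) (v , k′) → k ≡ k′
  Node-index-injective refl = refl

  InMν⊆InMs : ∀ {v k μ} → InMν M (v , k) μ → InMs M v μ
  InMν⊆InMs {v} (inj₁ refl) = Desc-refl v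
  InMν⊆InMs {v} (inj₂ (t , (pt≡v , _) , d)) =
    Desc-trans d (Desc-step (suc t) (subst (λ z → Desc M z v) (sym pt≡v) (Desc-refl v)))

  InMν-disjoint : ∀ {v} {k k′ : Fin (f v)} {μ} → k ≢ k′ →
                  InMν M (v , k) μ → InMν M (v , k′) μ → ⊥
  InMν-disjoint k≢k′ (inj₁ refl) (inj₁ eq) = k≢k′ (Node-index-injective eq)
  InMν-disjoint _ (inj₁ refl) (inj₂ (t′ , (pt′≡v , _) , d′)) =
    ¬Desc-parent t′ (subst (λ z → Desc M z (suc t′)) (sym pt′≡v) d′)
  InMν-disjoint _ (inj₂ (t , (pt≡v , _) , d)) (inj₁ refl) =
    ¬Desc-parent t (subst (λ z → Desc M z (suc t)) (sym pt≡v) d)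
  InMν-disjoint k≢k′ (inj₂ (t , (pt≡v , βt≡k+1) , d))
                     (inj₂ (t′ , (pt′≡v , βt′≡k′+1) , d′)) with t ≟ᶠ t′
  ... | yes refl = k≢k′ (toℕ-injective (suc-injective (trans (sym βt≡k+1) βt′≡k′+1)))
  ... | no  t≢t′ = ¬Desc-siblings (trans pt≡v (sym pt′≡v)) t≢t′ d d′

  ¬InMs-root : ∀ {s k} → ¬ InMs M (suc s) (zero , k)
  ¬InMs-root = ¬Desc-root

  ¬InMν-root : ∀ {i k k₀} → ¬ InMν M (suc i , k) (zero , k₀)
  ¬InMν-root (inj₁ ())
  ¬InMν-root (inj₂ (_ , _ , d)) = ¬Desc-root d

module LabelledTree {m n : ℕ} (e : Fin n → ℕ) (e≥2 : ∀ i → 2 ≤ e i) (M : MNTree n (vdata e))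
                    (ℓ : Node (vdata e) → Fin (suc m)) (ℓ-bijective : Bijective _≡_ _≡_ ℓ) where

  open MNTree M public
  open Tree M public

  f : Fin (suc n) → ℕ
  f = vdata e

  ℓ-injective : ∀ {μ μ′} → ℓ μ ≡ ℓ μ′ → μ ≡ μ′
  ℓ-injective = proj₁ ℓ-bijective

  ℓ⁻¹ : Fin (suc m) → Node f
  ℓ⁻¹ y = proj₁ (proj₂ ℓ-bijective y)

  ℓ-ℓ⁻¹ : ∀ y → ℓ (ℓ⁻¹ y) ≡ y
  ℓ-ℓ⁻¹ y = proj₂ (proj₂ ℓ-bijective y) refl

  ℓ⁻¹-ℓ : ∀ μ → ℓ⁻¹ (ℓ μ) ≡ μ
  ℓ⁻¹-ℓ μ = ℓ-injective (ℓ-ℓ⁻¹ (ℓ μ))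

  lab-ℓ⁻¹ : ∀ y → lab ℓ (ℓ⁻¹ y) ≡ suc (toℕ y)
  lab-ℓ⁻¹ y = cong (suc ∘ toℕ) (ℓ-ℓ⁻¹ y)

  lab-injective : ∀ {μ μ′} → lab ℓ μ ≡ lab ℓ μ′ → μ ≡ μ′
  lab-injective eq = ℓ-injective (toℕ-injective (suc-injective eq))

  root : Node f
  root = zero , zero

  root-unique : ∀ k → (zero , k) ≡ root
  root-unique zero = refl

  first-node : ∀ i → Fin (e i ∸ 1)
  first-node i = fromℕ< (∸-monoˡ-≤ 1 (e≥2 i))

  attachedTo : Node f → List (Fin (suc n))
  attachedTo (v , k) = filterᵇ (attachedᵇ M v k) (allFin (suc n))

  attachedLeft attachedRight : Node f → List (Fin (suc n))
  attachedLeft  μ = filterᵇ (below (toℕ (proj₁ μ))) (attachedTo μ)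
  attachedRight μ = filterᵇ (above (toℕ (proj₁ μ))) (attachedTo μ)

  no-vertex-0-attached : ∀ v (k : Fin (f v)) (p : Fin (suc n) → Bool) xs →
                         filterᵇ (below 1) (filterᵇ p (filterᵇ (attachedᵇ M v k) xs)) ≡ []
  no-vertex-0-attached v k p [] = refl
  no-vertex-0-attached v k p (zero  ∷ xs) = no-vertex-0-attached v k p xs
  no-vertex-0-attached v k p (suc j ∷ xs) with attachedᵇ M v k (suc j)
  ... | false = no-vertex-0-attached v k p xs
  ... | true with p (suc j)
  ...   | false = no-vertex-0-attached v k p xs
  ...   | true  = no-vertex-0-attached v k p xs

  -- The sequence of intervals in condition (iii), and the parts of it that remain once the
  -- factors of the vertices 1, …, c have been applied.
  module Sequences (αV βV : Fin (suc n) → ℕ) where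

    interval : Fin (suc n) → ℕ × ℕ
    interval w = αV w , βV w

    intervalsOf : List (Fin (suc n)) → List (ℕ × ℕ)
    intervalsOf ws = map interval (reverse ws)

    point : Node f → ℕ × ℕ
    point μ = lab ℓ μ , lab ℓ μ

    intervals : Node f → List (ℕ × ℕ)
    intervals μ = intervalsOf (attachedLeft μ) ++ point μ ∷ intervalsOf (attachedRight μ)

    remainingL remainingR : ℕ → Node f → List (ℕ × ℕ)
    remainingL c μ = intervalsOf (filterᵇ (below (suc c)) (attachedLeft μ))
                     ++ point μ ∷ intervalsOf (attachedRight μ)
    remainingR c μ = intervalsOf (filterᵇ (below (suc c)) (attachedRight μ))

  module _ {v : Fin (suc n)} {k : Fin (f v)} (p : Fin (suc n) → Bool) where

    private
      ≡true⇒T : ∀ {b} → b ≡ true → T b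
      ≡true⇒T = Equivalence.from T-≡

    attached-sorted : Sorted (filterᵇ p (attachedTo (v , k)))
    attached-sorted = filterᵇ-sorted p (filterᵇ-sorted (attachedᵇ M v k) allFin-sorted)

    ∈-attached : ∀ {w} → attachedᵇ M v k w ≡ true → p w ≡ true →
                 w ∈ filterᵇ p (attachedTo (v , k))
    ∈-attached {w} attached pw =
      ∈-filter⁺ (T? ∘ p) (∈-filter⁺ (T? ∘ attachedᵇ M v k) (∈-allFin w) (≡true⇒T attached))
                (≡true⇒T pw)

    ∉-attached : ∀ {w} → attachedᵇ M v k w ≡ false → ¬ w ∈ filterᵇ p (attachedTo (v , k))
    ∉-attached {w} not-attached w∈ = subst T not-attached
      (proj₂ (∈-filter⁻ (T? ∘ attachedᵇ M v k) {xs = allFin (suc n)}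
                        (proj₁ (∈-filter⁻ (T? ∘ p) w∈))))

-- From the interval conditions to a factorization

module FromConditions
  {m n : ℕ} (e : Fin n → ℕ) (e≥2 : ∀ i → 2 ≤ e i) (M : MNTree n (vdata e))
  (ℓ : Node (vdata e) → Fin (suc m)) (ℓ-bijective : Bijective _≡_ _≡_ ℓ) where

  open LabelledTree e e≥2 M ℓ ℓ-bijective

  module _
    (αN βN : Node f → ℕ) (αV βV : Fin (suc n) → ℕ)
    (range-V : ∀ j → 1 ≤ αV j × αV j ≤ βV j × βV j ≤ suc m)
    (cond-i : ∀ ν → IsInterval (LabelsOf ℓ (InMν M ν)) (αN ν) (βN ν))
    (cond-ii : ∀ j → IsInterval (LabelsOf ℓ (InMs M j)) (αV j) (βV j))
    (cond-iii : ∀ μ → Consec (αN μ) (Sequences.intervals αV βV μ) (βN μ))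
    (cond-iv : ∀ j → Consec (αV j) (map (λ k → (αN (j , k) , βN (j , k))) (allFin (f j))) (βV j))
    where

    open Sequences αV βV

    nodes-consecutive : ∀ j → Consec (αV j) (tabulate (λ k → (αN (j , k) , βN (j , k)))) (βV j)
    nodes-consecutive j = subst (λ L → Consec (αV j) L (βV j)) (map-tabulate (λ k → k) _) (cond-iv j)

    label-in-node-interval : ∀ ν → αN ν ≤ lab ℓ ν × lab ℓ ν ≤ βN ν
    label-in-node-interval ν = proj₁ (cond-i ν (lab ℓ ν)) (ν , inj₁ refl , refl)

    αV-root : αV zero ≡ 1
    αV-root = ≤-antisym (proj₁ (proj₁ (cond-ii zero 1) (ℓ⁻¹ zero , rooted _ , lab-ℓ⁻¹ zero)))
                        (proj₁ (range-V zero))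

    βV-root : βV zero ≡ suc m
    βV-root = ≤-antisym (proj₂ (proj₂ (range-V zero)))
      (subst (_≤ βV zero) (cong suc (toℕ-fromℕ m))
        (proj₂ (proj₁ (cond-ii zero _) (ℓ⁻¹ (fromℕ m) , rooted _ , lab-ℓ⁻¹ (fromℕ m)))))

    αN-root : αN root ≡ 1
    αN-root = trans (proj₁ (cond-iv zero)) αV-root

    βN-root : βN root ≡ suc m
    βN-root = trans (suc-injective (proj₂ (proj₂ (cond-iv zero)))) βV-root

    attachedLeft-root : attachedLeft root ≡ []
    attachedLeft-root = filterᵇ-none (below 0) (All.universal (λ _ → refl) (attachedTo root))

    ℓ-root : ℓ root ≡ zero
    ℓ-root = toℕ-injective (suc-injective (trans (proj₁ root-sequence) αN-root))
      where
        right = intervalsOf (attachedRight root)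
        root-sequence : Consec (αN root) (point root ∷ right) (βN root)
        root-sequence = subst (λ L → Consec (αN root) (intervalsOf L ++ point root ∷ right) (βN root))
                              attachedLeft-root (cond-iii root)

    attachmentLabel : Fin n → Fin (suc m)
    attachmentLabel i = ℓ (attachment i)

    nextOnCycle : ∀ i → Fin (e i ∸ 1) → Fin (suc m)
    nextOnCycle i k with suc (toℕ k) <? e i ∸ 1
    ... | yes k+1<f = ℓ (suc i , fromℕ< k+1<f)
    ... | no  _     = attachmentLabel i

    nextOnCycle-< : ∀ i k (k+1<f : suc (toℕ k) < e i ∸ 1) →
                    nextOnCycle i k ≡ ℓ (suc i , fromℕ< k+1<f)
    nextOnCycle-< i k k+1<f with suc (toℕ k) <? e i ∸ 1
    ... | yes k+1<f′ = cong (λ p → ℓ (suc i , fromℕ< p)) (<-irrelevant k+1<f′ k+1<f)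
    ... | no  k+1≮f  = ⊥-elim (k+1≮f k+1<f)

    nextOnCycle-last : ∀ i k → ¬ (suc (toℕ k) < e i ∸ 1) → nextOnCycle i k ≡ attachmentLabel i
    nextOnCycle-last i k k+1≮f with suc (toℕ k) <? e i ∸ 1
    ... | yes k+1<f = ⊥-elim (k+1≮f k+1<f)
    ... | no  _     = refl

    -- σ i is the cycle (ℓ (attachment i)  ℓ (suc i , 0)  ⋯  ℓ (suc i , e i - 2)).
    σ-on-nodes : Fin n → Node f → Fin (suc m)
    σ-on-nodes i (v , k) with v ≟ᶠ suc i
    ... | yes refl = nextOnCycle i k
    ... | no  _ with Node≟ (v , k) (attachment i)
    ...   | yes _ = ℓ (suc i , first-node i)
    ...   | no  _ = ℓ (v , k)

    σ : Fin n → Fin (suc m) → Fin (suc m)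
    σ i x = σ-on-nodes i (ℓ⁻¹ x)

    σ-own : ∀ i k → σ i (ℓ (suc i , k)) ≡ nextOnCycle i k
    σ-own i k rewrite ℓ⁻¹-ℓ (suc i , k) with suc i ≟ᶠ suc i
    ... | yes refl = refl
    ... | no  ne   = ⊥-elim (ne refl)

    σ-attachment : ∀ i → σ i (attachmentLabel i) ≡ ℓ (suc i , first-node i)
    σ-attachment i rewrite ℓ⁻¹-ℓ (attachment i) with parent i ≟ᶠ suc i
    ... | yes p≡i = ⊥-elim (parent≢self i p≡i)
    ... | no  _ with Node≟ (attachment i) (attachment i)
    ...   | yes _  = refl
    ...   | no  ne = ⊥-elim (ne refl)

    σ-other : ∀ i μ → proj₁ μ ≢ suc i → μ ≢ attachment i → σ i (ℓ μ) ≡ ℓ μ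
    σ-other i (v , k) v≢i μ≢att rewrite ℓ⁻¹-ℓ (v , k) with v ≟ᶠ suc i
    ... | yes v≡i = ⊥-elim (v≢i v≡i)
    ... | no  _ with Node≟ (v , k) (attachment i)
    ...   | yes μ≡att = ⊥-elim (μ≢att μ≡att)
    ...   | no  _     = refl

    prefix : ℕ → Fin (suc m) → Fin (suc m)
    prefix = segment σ 0

    prefix-suc : ∀ {c} (c<n : c < n) x → prefix (suc c) x ≡ prefix c (σ (fromℕ< c<n) x)
    prefix-suc {c} c<n x = cong (prefix c) (factor-< σ c<n x)

    -- The invariant of the induction on c: the factors of the vertices 1, …, c carry the label of μ
    -- to the start of the part of its sequence in condition (iii) made of the vertices processed so
    -- far (on the left of ℓ μ) and of everything from ℓ μ on (on the right); the start d + 1 means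
    -- the label 1.
    ClaimL ClaimR : ℕ → Node f → Set
    ClaimL c μ = c < toℕ (proj₁ μ) →
                 ∀ s → Consec s (remainingL c μ) (βN μ) → prefix c (ℓ μ) ≡ fromLabel⁺ s
    ClaimR c μ = toℕ (proj₁ μ) ≤ c →
                 ∀ s → Consec s (remainingR c μ) (βN μ) → prefix c (ℓ μ) ≡ fromLabel⁺ s

    Claim : ℕ → Set
    Claim c = ∀ μ → ClaimL c μ × ClaimR c μ

    prefix-node-start : ∀ c ν → suc c ≡ toℕ (proj₁ ν) → ClaimL c ν →
                        prefix c (ℓ ν) ≡ fromLabel⁺ (αN ν)
    prefix-node-start c (v , k) c+1≡v claim =
      claim (subst (c <_) c+1≡v ≤-refl) (αN (v , k))
        (subst (λ L → Consec (αN (v , k)) (intervalsOf L ++ _) (βN (v , k)))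
               (sym all-processed) (cond-iii (v , k)))
      where
        all-processed : filterᵇ (below (suc c)) (attachedLeft (v , k)) ≡ attachedLeft (v , k)
        all-processed = filterᵇ-redundant (below (suc c)) (below (toℕ v))
                          (λ u u<v → subst (λ t → (toℕ u <ᵇ t) ≡ true) (sym c+1≡v) u<v)
                          (attachedTo (v , k))

    claim-0 : Claim 0
    claim-0 μ = claimL μ , claimR μ
      where
        claimL : ∀ μ → ClaimL 0 μ
        claimL (v , k) _ s cs =
          trans (sym (fromLabel⁺-label (ℓ (v , k))))
                (cong fromLabel⁺ (proj₁ (subst (λ L → Consec s (intervalsOf L ++ rest) (βN (v , k)))
                                               (no-vertex-0-attached v k (below (toℕ v)) (allFin (suc n))) cs)))
          where rest = point (v , k) ∷ intervalsOf (attachedRight (v , k))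
        claimR : ∀ μ → ClaimR 0 μ
        claimR (zero , zero) _ s cs =
          trans ℓ-root (trans (sym fromLabel⁺-top)
                              (cong fromLabel⁺ (trans (cong suc (sym βN-root)) (sym s≡))))
          where
            s≡ : s ≡ suc (βN root)
            s≡ = subst (λ L → Consec s (intervalsOf L) (βN root))
                       (no-vertex-0-attached zero zero (above 0) (allFin (suc n))) cs
        claimR (suc v , k) ()

    module Step (c : ℕ) (c<n : c < n) (IH : Claim c) where
      i : Fin n
      i = fromℕ< c<n
      w : Fin (suc n)
      w = suc i
      toℕ-w : toℕ w ≡ suc c
      toℕ-w = cong suc (toℕ-fromℕ< c<n)

      prefix-first-node : prefix c (ℓ (w , first-node i)) ≡ fromLabel⁺ (αV w)
      prefix-first-node =
        trans (prefix-node-start c (w , first-node i) (sym toℕ-w) (proj₁ (IH (w , first-node i))))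
              (cong fromLabel⁺ (Consec-tabulate-first _ (∸-monoˡ-≤ 1 (e≥2 i)) (nodes-consecutive w)))

      σ-attached : ∀ v k → attachedᵇ M v k w ≡ true → σ i (ℓ (v , k)) ≡ ℓ (w , first-node i)
      σ-attached v k att =
        trans (cong (σ i ∘ ℓ) (sym (Attached⇒≡attachment (attachedᵇ⇒Attached att)))) (σ-attachment i)

      σ-unattached : ∀ v k → attachedᵇ M v k w ≡ false → v ≢ w → σ i (ℓ (v , k)) ≡ ℓ (v , k)
      σ-unattached v k ¬att v≢w = σ-other i (v , k) v≢w λ μ≡att →
        false≢true (trans (sym ¬att) (Attached⇒attachedᵇ (≡attachment⇒Attached (sym μ≡att))))
        where
          false≢true : false ≢ true
          false≢true ()

      -- If w is attached to (v , k), its factor moves ℓ (v , k) to the first node of w, whose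
      -- label is the start of w's interval; otherwise it fixes ℓ (v , k).
      step-past : ∀ v k (p : Fin (suc n) → Bool) → p w ≡ true → v ≢ w →
                  (rest : List (ℕ × ℕ)) → ∀ hi → let ys = filterᵇ p (attachedTo (v , k)) in
        (∀ s → Consec s (intervalsOf (filterᵇ (below (suc c)) ys) ++ rest) hi →
               prefix c (ℓ (v , k)) ≡ fromLabel⁺ s) →
        ∀ s → Consec s (intervalsOf (filterᵇ (below (suc (suc c))) ys) ++ rest) hi →
              prefix (suc c) (ℓ (v , k)) ≡ fromLabel⁺ s
      step-past v k p pw v≢w rest hi claim s cs with attachedᵇ M v k w in att
      ... | true = begin
          prefix (suc c) (ℓ (v , k))      ≡⟨ prefix-suc c<n _ ⟩
          prefix c (σ i (ℓ (v , k)))      ≡⟨ cong (prefix c) (σ-attached v k att) ⟩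
          prefix c (ℓ (w , first-node i)) ≡⟨ prefix-first-node ⟩
          fromLabel⁺ (αV w)               ≡⟨ cong fromLabel⁺ (proj₁ cs′) ⟩
          fromLabel⁺ s                    ∎
        where
          cs′ = subst (λ L → Consec s (map interval L ++ rest) hi)
                  (reverse-filterᵇ-below-suc-∈ w _ toℕ-w (attached-sorted p) (∈-attached p att pw)) cs
      ... | false = begin
          prefix (suc c) (ℓ (v , k))      ≡⟨ prefix-suc c<n _ ⟩
          prefix c (σ i (ℓ (v , k)))      ≡⟨ cong (prefix c) (σ-unattached v k att v≢w) ⟩
          prefix c (ℓ (v , k))            ≡⟨ claim s cs′ ⟩
          fromLabel⁺ s                    ∎
        where
          cs′ = subst (λ L → Consec s (map interval L ++ rest) hi)
                  (reverse-filterᵇ-below-suc-∉ w _ toℕ-w (attached-sorted p) (∉-attached p att)) cs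

      split-at-w : ∀ ys → Sorted ys → w ∈ ys →
        intervalsOf ys ≡
        intervalsOf (filterᵇ (above (suc c)) ys) ++ interval w ∷ intervalsOf (filterᵇ (below (suc c)) ys)
      split-at-w ys sorted w∈ys =
        trans (cong (map interval) (reverse-split w ys toℕ-w sorted w∈ys))
              (map-++ interval (reverse (filterᵇ (above (suc c)) ys))
                               (w ∷ reverse (filterᵇ (below (suc c)) ys)))

      w-attached : attachedᵇ M (parent i) (proj₂ (attachment i)) w ≡ true
      w-attached = Attached⇒attachedᵇ (≡attachment⇒Attached refl)

      -- In the sequence of the node that w hangs from, what remains after step c starts right
      -- after w's interval.
      prefix-attachment : prefix c (attachmentLabel i) ≡ fromLabel⁺ (suc (βV w))
      prefix-attachment with c <? toℕ (parent i)
      ... | yes c<v =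
        proj₁ (IH μ) c<v _ (Consec-suffix A (subst (λ L → Consec (αN μ) L (βN μ)) sequence (cond-iii μ)))
        where
          μ = attachment i
          w<v : toℕ w < toℕ (parent i)
          w<v = ≤∧≢⇒< (subst (_≤ toℕ (parent i)) (sym toℕ-w) c<v)
                      (λ eq → parent≢self i (sym (toℕ-injective eq)))
          A = intervalsOf (filterᵇ (above (suc c)) (attachedLeft μ))
          R = intervalsOf (attachedRight μ)
          sequence : intervals μ ≡ A ++ interval w ∷ remainingL c μ
          sequence = trans (cong (_++ point μ ∷ R) (split-at-w _ (attached-sorted _)
                                                      (∈-attached _ w-attached (<⇒<ᵇ≡true w<v))))
                           (++-assoc A (interval w ∷ _) (point μ ∷ R))
      ... | no c≮v =
        proj₂ (IH μ) (≮⇒≥ c≮v) _ (Consec-suffix A (subst (λ L → Consec (αN μ) L (βN μ)) sequence (cond-iii μ)))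
        where
          μ = attachment i
          v<w : toℕ (parent i) < toℕ w
          v<w = subst (toℕ (parent i) <_) (sym toℕ-w) (s≤s (≮⇒≥ c≮v))
          L = intervalsOf (attachedLeft μ)
          A = L ++ point μ ∷ intervalsOf (filterᵇ (above (suc c)) (attachedRight μ))
          sequence : intervals μ ≡ A ++ interval w ∷ remainingR c μ
          sequence = trans (cong (λ R → L ++ point μ ∷ R) (split-at-w _ (attached-sorted _)
                                                             (∈-attached _ w-attached (<⇒<ᵇ≡true v<w))))
                           (sym (++-assoc L (point μ ∷ _) (interval w ∷ remainingR c μ)))

      nothing-remains : ∀ k → filterᵇ (below (suc (suc c))) (attachedRight (w , k)) ≡ []
      nothing-remains k = subst (λ t → filterᵇ (below (suc t)) (attachedRight (w , k)) ≡ [])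
                                toℕ-w (filterᵇ-below-above (toℕ w) (attachedTo (w , k)))

      own-node : ∀ k → ClaimR (suc c) (w , k)
      own-node k _ s cs with suc (toℕ k) <? e i ∸ 1
      ... | yes k+1<f = begin
          prefix (suc c) (ℓ (w , k))
            ≡⟨ prefix-suc c<n _ ⟩
          prefix c (σ i (ℓ (w , k)))
            ≡⟨ cong (prefix c) (trans (σ-own i k) (nextOnCycle-< i k k+1<f)) ⟩
          prefix c (ℓ (w , k+1))
            ≡⟨ prefix-node-start c _ (sym toℕ-w) (proj₁ (IH (w , k+1))) ⟩
          fromLabel⁺ (αN (w , k+1))
            ≡⟨ cong fromLabel⁺ (Consec-tabulate-next _ nodes-w k k+1<f) ⟩
          fromLabel⁺ (suc (βN (w , k)))
            ≡⟨ cong fromLabel⁺ (sym s≡) ⟩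
          fromLabel⁺ s
            ∎
        where
          k+1 = fromℕ< k+1<f
          nodes-w = nodes-consecutive w
          s≡ = subst (λ L → Consec s (intervalsOf L) (βN (w , k))) (nothing-remains k) cs
      ... | no k+1≮f = begin
          prefix (suc c) (ℓ (w , k))
            ≡⟨ prefix-suc c<n _ ⟩
          prefix c (σ i (ℓ (w , k)))
            ≡⟨ cong (prefix c) (trans (σ-own i k) (nextOnCycle-last i k k+1≮f)) ⟩
          prefix c (attachmentLabel i)
            ≡⟨ prefix-attachment ⟩
          fromLabel⁺ (suc (βV w))
            ≡⟨ cong (fromLabel⁺ ∘ suc) (sym (Consec-tabulate-last _ nodes-w k k+1≮f)) ⟩
          fromLabel⁺ (suc (βN (w , k)))
            ≡⟨ cong fromLabel⁺ (sym s≡) ⟩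
          fromLabel⁺ s
            ∎
        where
          nodes-w = nodes-consecutive w
          s≡ = subst (λ L → Consec s (intervalsOf L) (βN (w , k))) (nothing-remains k) cs

      claimL : ∀ μ → ClaimL (suc c) μ
      claimL (v , k) c+1<v =
        step-past v k (below (toℕ v)) (<⇒<ᵇ≡true (subst (_< toℕ v) (sym toℕ-w) c+1<v))
          (λ v≡w → <-irrefl (trans (sym toℕ-w) (cong toℕ (sym v≡w))) c+1<v) _ (βN (v , k))
          (proj₁ (IH (v , k)) (<-trans (n<1+n c) c+1<v))

      claimR : ∀ μ → ClaimR (suc c) μ
      claimR (v , k) v≤c+1 with m≤n⇒m<n∨m≡n v≤c+1
      ... | inj₂ v≡c+1 with refl ← toℕ-injective {i = v} {j = w} (trans v≡c+1 (sym toℕ-w)) =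
        own-node k v≤c+1
      ... | inj₁ v<c+1 = λ s cs →
        step-past v k (above (toℕ v)) (<⇒<ᵇ≡true v<w) (λ v≡w → <-irrefl (cong toℕ v≡w) v<w)
          [] (βN (v , k))
          (λ s′ cs′ → proj₂ (IH (v , k)) (≤-pred v<c+1) s′
                        (subst (λ L → Consec s′ L (βN (v , k))) (++[] c) cs′))
          s (subst (λ L → Consec s L (βN (v , k))) (sym (++[] (suc c))) cs)
        where
          v<w = subst (toℕ v <_) (sym toℕ-w) v<c+1
          ++[] = λ c′ → ++-identityʳ (remainingR c′ (v , k))

      claim : Claim (suc c)
      claim μ = claimL μ , claimR μ

    claims : ∀ c → c ≤ n → Claim c
    claims zero    _     = claim-0
    claims (suc c) c+1≤n = Step.claim c c+1≤n (claims c (≤-trans (n≤1+n c) c+1≤n))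

    prod-σ≡tau : ∀ x → prod σ x ≡ tau m x
    prod-σ≡tau x = begin
        prod σ x             ≡⟨ prod≡segment σ x ⟩
        prefix n x           ≡⟨ cong (prefix n) (sym (ℓ-ℓ⁻¹ x)) ⟩
        prefix n (ℓ μ)       ≡⟨ proj₂ (claims n ≤-refl μ) (≤-pred (toℕ<n (proj₁ μ))) _ rest ⟩
        tau m (ℓ μ)          ≡⟨ cong (tau m) (ℓ-ℓ⁻¹ x) ⟩
        tau m x              ∎
      where
        μ = ℓ⁻¹ x
        all-processed : filterᵇ (below (suc n)) (attachedRight μ) ≡ attachedRight μ
        all-processed = filterᵇ-all (below (suc n)) (All.universal (λ u → <⇒<ᵇ≡true (toℕ<n u)) _)
        rest : Consec (suc (lab ℓ μ)) (remainingR n μ) (βN μ)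
        rest = subst (λ L → Consec (suc (lab ℓ μ)) (intervalsOf L) (βN μ)) (sym all-processed)
                         (Consec-suffix (intervalsOf (attachedLeft μ)) (cond-iii μ))

    private
      suc<⇒<∸1 : ∀ {j x} → suc j < x → j < x ∸ 1
      suc<⇒<∸1 {x = suc x} (s≤s j<x) = j<x

      <∸1⇒suc< : ∀ {j x} → j < x ∸ 1 → suc j < x
      <∸1⇒suc< {x = suc x} j<x = s≤s j<x

    cycleAt : ∀ i t → t < e i → Fin (suc m)
    cycleAt i zero    _       = attachmentLabel i
    cycleAt i (suc j) j+1<e = ℓ (suc i , fromℕ< (suc<⇒<∸1 j+1<e))

    cycleAt-cong : ∀ i {t t′} → t ≡ t′ → (p : t < e i) (p′ : t′ < e i) →
                   cycleAt i t p ≡ cycleAt i t′ p′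
    cycleAt-cong i refl p p′ = cong (cycleAt i _) (<-irrelevant p p′)

    cycle : ∀ i → Fin (e i) → Fin (suc m)
    cycle i k = cycleAt i (toℕ k) (toℕ<n k)

    attachmentLabel≢own : ∀ i k → attachmentLabel i ≢ ℓ (suc i , k)
    attachmentLabel≢own i k eq = parent≢self i (cong proj₁ (ℓ-injective eq))

    cycleAt-injective : ∀ i t t′ p p′ → cycleAt i t p ≡ cycleAt i t′ p′ → t ≡ t′
    cycleAt-injective i zero    zero     p p′ eq = refl
    cycleAt-injective i zero    (suc j′) p p′ eq = ⊥-elim (attachmentLabel≢own i _ eq)
    cycleAt-injective i (suc j) zero     p p′ eq = ⊥-elim (attachmentLabel≢own i _ (sym eq))
    cycleAt-injective i (suc j) (suc j′) p p′ eq =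
      cong suc (trans (sym (toℕ-fromℕ< _))
                      (trans (cong toℕ (Node-index-injective (ℓ-injective eq))) (toℕ-fromℕ< _)))

    cycleAt-step : ∀ i t p t′ p′ → t′ ≡ suc t ⊎ (t′ ≡ 0 × suc t ≡ e i) →
                   σ i (cycleAt i t p) ≡ cycleAt i t′ p′
    cycleAt-step i zero p .1 p′ (inj₁ refl) =
      trans (σ-attachment i)
            (cong (λ k → ℓ (suc i , k)) (toℕ-injective (trans (toℕ-fromℕ< _) (sym (toℕ-fromℕ< _)))))
    cycleAt-step i zero p t′ p′ (inj₂ (_ , 1≡e)) = ⊥-elim (<-irrefl 1≡e (e≥2 i))
    cycleAt-step i (suc j) p t′ p′ t′-next = from-own (suc (toℕ k) <? e i ∸ 1) t′-next
      where
        k = fromℕ< (suc<⇒<∸1 p)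
        toℕ-k : toℕ k ≡ j
        toℕ-k = toℕ-fromℕ< (suc<⇒<∸1 p)
        from-own : Dec (suc (toℕ k) < e i ∸ 1) →
                   t′ ≡ suc (suc j) ⊎ (t′ ≡ 0 × suc (suc j) ≡ e i) → σ i (ℓ (suc i , k)) ≡ cycleAt i t′ p′
        from-own (yes k+1<f) (inj₁ refl) =
          trans (σ-own i k) (trans (nextOnCycle-< i k k+1<f) (cong (λ k′ → ℓ (suc i , k′))
            (toℕ-injective (trans (toℕ-fromℕ< k+1<f) (trans (cong suc toℕ-k) (sym (toℕ-fromℕ< _)))))))
        from-own (yes k+1<f) (inj₂ (_ , j+2≡e)) =
          ⊥-elim (<-irrefl j+2≡e (subst (λ z → suc (suc z) < e i) toℕ-k (<∸1⇒suc< k+1<f)))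
        from-own (no k+1≮f) (inj₁ refl) =
          ⊥-elim (k+1≮f (subst (λ z → suc z < e i ∸ 1) (sym toℕ-k) (suc<⇒<∸1 p′)))
        from-own (no k+1≮f) (inj₂ (refl , _)) = trans (σ-own i k) (nextOnCycle-last i k k+1≮f)

    off-cycle : ∀ i μ → (∀ k → cycle i k ≢ ℓ μ) → σ i (ℓ μ) ≡ ℓ μ
    off-cycle i (v , k) ∉cycle with v ≟ᶠ suc i
    ... | yes refl = ⊥-elim (∉cycle (fromℕ< k+1<e)
          (trans (cycleAt-cong i (toℕ-fromℕ< k+1<e) _ k+1<e)
                 (cong (λ k′ → ℓ (suc i , k′)) (toℕ-injective (toℕ-fromℕ< _)))))
      where k+1<e = <∸1⇒suc< (toℕ<n k)
    ... | no v≢i with Node≟ (v , k) (attachment i)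
    ...   | yes μ≡att = ⊥-elim (∉cycle (fromℕ< 0<e)
          (trans (cycleAt-cong i (toℕ-fromℕ< 0<e) _ 0<e) (cong ℓ (sym μ≡att))))
      where 0<e = <-trans z<s (e≥2 i)
    ...   | no μ≢att = σ-other i (v , k) v≢i μ≢att

    σ-isCycle : ∀ i → IsCycle (e i) (σ i)
    σ-isCycle i =
      cycle i ,
      (λ eq → toℕ-injective (cycleAt-injective i _ _ _ _ eq)) ,
      (λ k j j-next → cycleAt-step i (toℕ k) (toℕ<n k) (toℕ j) (toℕ<n j) j-next) ,
      (λ x ∉cycle → trans (cong (σ i) (sym (ℓ-ℓ⁻¹ x)))
                          (trans (off-cycle i (ℓ⁻¹ x) (λ k eq → ∉cycle k (trans eq (ℓ-ℓ⁻¹ x))))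
                                 (ℓ-ℓ⁻¹ x)))

    ℓ⁻¹-suc : ∀ y → Σ[ i ∈ Fin n ] Σ[ k ∈ Fin (e i ∸ 1) ] ℓ⁻¹ (suc y) ≡ (suc i , k)
    ℓ⁻¹-suc y with ℓ⁻¹ (suc y) in eq
    ... | zero  , k
      with () ← trans (sym ℓ-root) (trans (cong ℓ (sym (trans eq (root-unique k)))) (ℓ-ℓ⁻¹ (suc y)))
    ... | suc i , k = i , k , refl

    owner : Fin m → Fin n
    owner y = proj₁ (ℓ⁻¹-suc y)

    ℓ-owned : ∀ y → Σ[ k ∈ Fin (e (owner y) ∸ 1) ] ℓ (suc (owner y) , k) ≡ suc y
    ℓ-owned y with i , k , eq ← ℓ⁻¹-suc y = k , trans (cong ℓ (sym eq)) (ℓ-ℓ⁻¹ (suc y))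

    ℓ-own : ∀ i k → Σ[ y ∈ Fin m ] (ℓ (suc i , k) ≡ suc y × owner y ≡ i)
    ℓ-own i k with ℓ (suc i , k) in eq
    ... | zero  with () ← ℓ-injective (trans eq (sym ℓ-root))
    ... | suc y = y , refl ,
      Fin-suc-injective (,-injectiveˡ (trans (sym (proj₂ (proj₂ (ℓ⁻¹-suc y))))
                                             (trans (cong ℓ⁻¹ (sym eq)) (ℓ⁻¹-ℓ _))))

    σ-moves-attachment : ∀ i → σ i (attachmentLabel i) ≢ attachmentLabel i
    σ-moves-attachment i eq = attachmentLabel≢own i (first-node i) (sym (trans (sym (σ-attachment i)) eq))

    σ-moves-own : ∀ i k → σ i (ℓ (suc i , k)) ≢ ℓ (suc i , k)
    σ-moves-own i k eq with suc (toℕ k) <? e i ∸ 1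
    ... | yes k+1<f =
      1+n≢n (trans (sym (toℕ-fromℕ< k+1<f)) (cong toℕ (Node-index-injective (ℓ-injective next≡own))))
      where next≡own = trans (sym (nextOnCycle-< i k k+1<f)) (trans (sym (σ-own i k)) eq)
    ... | no  k+1≮f =
      attachmentLabel≢own i k (trans (sym (nextOnCycle-last i k k+1≮f)) (trans (sym (σ-own i k)) eq))

    σ-moves-owned : ∀ y → σ (owner y) (suc y) ≢ suc y
    σ-moves-owned y with k , ℓ≡ ← ℓ-owned y =
      subst (λ z → σ (owner y) z ≢ z) ℓ≡ (σ-moves-own (owner y) k)

    σ-moved-node : ∀ i μ → σ i (ℓ μ) ≢ ℓ μ →
                   attachmentLabel i ≡ ℓ μ ⊎ Σ[ y ∈ Fin m ] (ℓ μ ≡ suc y × owner y ≡ i)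
    σ-moved-node i (v , k) moved with v ≟ᶠ suc i
    ... | yes refl = inj₂ (ℓ-own i k)
    ... | no v≢i with Node≟ (v , k) (attachment i)
    ...   | yes μ≡att = inj₁ (cong ℓ (sym μ≡att))
    ...   | no  μ≢att = ⊥-elim (moved (σ-other i (v , k) v≢i μ≢att))

    σ-moved : ∀ i x → σ i x ≢ x → attachmentLabel i ≡ x ⊎ Σ[ y ∈ Fin m ] (x ≡ suc y × owner y ≡ i)
    σ-moved i x moved =
      subst (λ z → attachmentLabel i ≡ z ⊎ Σ[ y ∈ Fin m ] (z ≡ suc y × owner y ≡ i)) (ℓ-ℓ⁻¹ x)
        (σ-moved-node i (ℓ⁻¹ x) (subst (λ z → σ i z ≢ z) (sym (ℓ-ℓ⁻¹ x)) moved))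

    -- Going up in G leads from a label to its vertex and from a vertex to the label of its
    -- attachment node, so it follows the parents in M.
    private
      graph-step : Fin (suc m) ⊎ Fin n → Fin (suc m) ⊎ Fin n
      graph-step = gstep attachmentLabel owner

      node-reaches-root : ∀ depth v → iter (tpar parent) depth v ≡ zero →
                          ∀ k → ∃[ t ] iter graph-step t (inj₁ (ℓ (v , k))) ≡ inj₁ zero
      vertex-reaches-root : ∀ depth i → iter (tpar parent) depth (suc i) ≡ zero →
                            ∃[ t ] iter graph-step t (inj₂ i) ≡ inj₁ zero
      node-reaches-root depth zero    _       zero = 0 , cong inj₁ ℓ-root
      node-reaches-root depth (suc i) reaches k
        with y , ℓ≡ , owner≡ ← ℓ-own i k | t , reaches′ ← vertex-reaches-root depth i reaches =
        suc t , trans (iter-suc graph-step t (inj₁ (ℓ (suc i , k))))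
                      (trans (cong (λ z → iter graph-step t (graph-step (inj₁ z))) ℓ≡)
                             (subst (λ j → iter graph-step t (inj₂ j) ≡ inj₁ zero) (sym owner≡) reaches′))
      vertex-reaches-root zero        i ()
      vertex-reaches-root (suc depth) i reaches
        with t , reaches′ ← node-reaches-root depth (parent i)
                              (trans (sym (iter-suc (tpar parent) depth (suc i))) reaches)
                              (proj₂ (attachment i)) =
        suc t , trans (iter-suc graph-step t (inj₂ i)) reaches′

    graph-rooted : ∀ v → ∃[ t ] iter (gstep attachmentLabel owner) t v ≡ inj₁ zero
    graph-rooted (inj₁ x)
      with depth , reaches ← rooted (proj₁ (ℓ⁻¹ x))
      with t , reaches′ ← node-reaches-root depth (proj₁ (ℓ⁻¹ x)) reaches (proj₂ (ℓ⁻¹ x)) =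
      t , subst (λ z → iter graph-step t (inj₁ z) ≡ inj₁ zero) (ℓ-ℓ⁻¹ x) reaches′
    graph-rooted (inj₂ i) with depth , reaches ← rooted (suc i) = vertex-reaches-root depth i reaches

    factorization : Factorization n m e
    factorization = record { σ = σ ; cyc = σ-isCycle ; product = prod-σ≡tau }

    rooting : Rooting factorization
    rooting = record
      { pS = attachmentLabel ; pL = owner ; pS-adj = σ-moves-attachment ; pL-adj = σ-moves-owned
      ; edges = σ-moved ; rooted = graph-rooted }

    children : (i : Fin n) → Fin (e i ∸ 1) → Fin (suc m)
    children i k = ℓ (suc i , k)

    children-increasing : ∀ i k k′ → toℕ k < toℕ k′ → toℕ (children i k) < toℕ (children i k′)
    children-increasing i k k′ k<k′ =
      ≤-pred (≤-trans (s≤s (proj₂ (label-in-node-interval (suc i , k))))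
                      (≤-trans (Consec-tabulate-sorted _ (nodes-consecutive (suc i)) k k′ k<k′)
                               (proj₁ (label-in-node-interval (suc i , k′)))))

    children-complete : ∀ i x → Σ[ y ∈ Fin m ] (x ≡ suc y × owner y ≡ i) →
                        ∃[ k ] children i k ≡ x
    children-complete i x (y , refl , refl) = ℓ-owned y

    AttachedToOwnNode : Fin n → Fin m → Set
    AttachedToOwnNode i y = parent i ≡ suc (owner y) ×
      Σ[ k ∈ Fin (e (owner y) ∸ 1) ] (children (owner y) k ≡ suc y × suc (toℕ k) ≡ β i)

    attachment-parent : ∀ i → (attachmentLabel i ≡ zero → parent i ≡ zero × β i ≡ 1) ×
                              (∀ y → attachmentLabel i ≡ suc y → AttachedToOwnNode i y)
    attachment-parent i = at-root , at-node
      where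
        at-root : attachmentLabel i ≡ zero → parent i ≡ zero × β i ≡ 1
        at-root eq = ≡attachment⇒Attached (ℓ-injective (trans eq (sym ℓ-root)))
        at-node : ∀ y → attachmentLabel i ≡ suc y → AttachedToOwnNode i y
        at-node y eq with k , ℓ≡ ← ℓ-owned y =
          proj₁ attached , k , ℓ≡ , sym (proj₂ attached)
          where attached = ≡attachment⇒Attached (ℓ-injective (trans eq (sym ℓ≡)))

    inLMR : InLMR M ℓ
    inLMR = factorization , rooting , children , children-increasing , children-complete , ℓ-own ,
            ℓ-root , (λ _ _ → refl) , attachment-parent

-- From a factorization to the interval conditions

module ToConditions
  {m n : ℕ} (e : Fin n → ℕ) (e≥2 : ∀ i → 2 ≤ e i) (M : MNTree n (vdata e))
  (ℓ : Node (vdata e) → Fin (suc m)) (ℓ-bijective : Bijective _≡_ _≡_ ℓ) where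

  open LabelledTree e e≥2 M ℓ ℓ-bijective

  module _
    (F : Factorization n m e) (R : Rooting F)
    (children : (i : Fin n) → Fin (e i ∸ 1) → Fin (suc m))
    (children-increasing : ∀ i k k′ → toℕ k < toℕ k′ → toℕ (children i k) < toℕ (children i k′))
    (children-complete : ∀ i x → Σ[ y ∈ Fin m ] (x ≡ suc y × Rooting.pL R y ≡ i) →
                         ∃[ k ] children i k ≡ x)
    (children-owned : ∀ i k → Σ[ y ∈ Fin m ] (children i k ≡ suc y × Rooting.pL R y ≡ i))
    (ℓ-root : ℓ root ≡ zero)
    (ℓ-children : ∀ i k → ℓ (suc i , k) ≡ children i k)
    (parents : ∀ i → (Rooting.pS R i ≡ zero → parent i ≡ zero × β i ≡ 1)
                   × (∀ y → Rooting.pS R i ≡ suc y →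
                        parent i ≡ suc (Rooting.pL R y)
                        × Σ[ k ∈ Fin (e (Rooting.pL R y) ∸ 1) ]
                            (children (Rooting.pL R y) k ≡ suc y × suc (toℕ k) ≡ β i)))
    where

    open Factorization F
    open Rooting R using (pS; pL; pS-adj; pL-adj; edges)

    σ-injective : ∀ i → Injective _≡_ _≡_ (σ i)
    σ-injective i = cycle-injective (cyc i)

    open Factorisation σ (tau m) product σ-injective

    ℓ-attachment : ∀ i → ℓ (attachment i) ≡ pS i
    ℓ-attachment i with pS i in eq
    ... | zero = trans (cong ℓ (Attached⇒≡attachment (proj₁ (parents i) eq))) ℓ-root
    ... | suc y with p≡ , k , ch≡ , β≡ ← proj₂ (parents i) y eq =
      trans (cong ℓ (Attached⇒≡attachment (p≡ , sym β≡))) (trans (ℓ-children (pL y) k) ch≡)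

    image : Fin n → Node f → Node f
    image t μ = ℓ⁻¹ (σ t (ℓ μ))

    ℓ-image : ∀ t μ → ℓ (image t μ) ≡ σ t (ℓ μ)
    ℓ-image t μ = ℓ-ℓ⁻¹ _

    image-fixed : ∀ t μ → σ t (ℓ μ) ≡ ℓ μ → image t μ ≡ μ
    image-fixed t μ eq = trans (cong ℓ⁻¹ eq) (ℓ⁻¹-ℓ μ)

    image-moved : ∀ t μ → σ t (ℓ μ) ≢ ℓ μ → σ t (ℓ (image t μ)) ≢ ℓ (image t μ)
    image-moved t μ moved eq =
      moved (σ-injective t (trans (cong (σ t) (sym (ℓ-image t μ))) (trans eq (ℓ-image t μ))))

    Support : Fin n → Node f → Set
    Support t μ = proj₁ μ ≡ suc t ⊎ μ ≡ attachment t

    moved⇒Support : ∀ t μ → σ t (ℓ μ) ≢ ℓ μ → Support t μ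
    moved⇒Support t μ moved with edges t (ℓ μ) moved
    ... | inj₁ pS≡ℓ = inj₂ (ℓ-injective (trans (sym pS≡ℓ) (sym (ℓ-attachment t))))
    ... | inj₂ owned with k , ch≡ ← children-complete t (ℓ μ) owned =
      inj₁ (cong proj₁ (ℓ-injective (trans (sym ch≡) (sym (ℓ-children t k)))))

    σ-moves-own : ∀ i k → σ i (ℓ (suc i , k)) ≢ ℓ (suc i , k)
    σ-moves-own i k eq with y , ch≡ , pL≡ ← children-owned i k =
      pL-adj y (subst (λ j → σ j (suc y) ≡ suc y) (sym pL≡)
                      (subst (λ z → σ i z ≡ z) (trans (ℓ-children i k) ch≡) eq))

    Support⇒Desc : ∀ t s μ → InMs M (suc s) μ → Support t μ → Desc M (suc t) (suc s)
    Support⇒Desc t s μ d (inj₁ μ∈t)    = subst (λ z → Desc M z (suc s)) μ∈t d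
    Support⇒Desc t s μ d (inj₂ μ≡att) =
      Desc-step (suc t) (subst (λ z → Desc M (proj₁ z) (suc s)) μ≡att d)

    image-InMs : ∀ t s μ → InMs M (suc s) μ →
                 InMs M (suc s) (image t μ) ⊎ (t ≡ s × image t μ ≡ attachment s)
    image-InMs t s μ d with σ t (ℓ μ) ≟ᶠ ℓ μ
    ... | yes fixed = inj₁ (subst (InMs M (suc s)) (sym (image-fixed t μ fixed)) d)
    ... | no moved with moved⇒Support t (image t μ) (image-moved t μ moved)
    ...   | inj₁ in-t = inj₁ (subst (λ z → Desc M z (suc s)) (sym in-t) t-below-s)
      where t-below-s = Support⇒Desc t s μ d (moved⇒Support t μ moved)
    ...   | inj₂ ≡att with t ≟ᶠ s
    ...     | yes refl = inj₂ (refl , ≡att)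
    ...     | no  t≢s  = inj₁ (subst (λ z → Desc M (proj₁ z) (suc s)) (sym ≡att)
                                     (Desc-up (suc t) t-below-s (t≢s ∘ Fin-suc-injective)))
      where t-below-s = Support⇒Desc t s μ d (moved⇒Support t μ moved)

    InMs-preserved : ∀ s t → t ≢ s → ∀ μ → InMs M (suc s) μ → InMs M (suc s) (image t μ)
    InMs-preserved s t t≢s μ d with image-InMs t s μ d
    ... | inj₁ d′         = d′
    ... | inj₂ (t≡s , _) = ⊥-elim (t≢s t≡s)

    InMs-exit : ∀ s μ → InMs M (suc s) μ → ¬ InMs M (suc s) (image s μ) → σ s (ℓ μ) ≡ pS s
    InMs-exit s μ d out with σ s (ℓ μ) ≟ᶠ ℓ μ
    ... | yes fixed = ⊥-elim (out (subst (InMs M (suc s)) (sym (image-fixed s μ fixed)) d))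
    ... | no moved with moved⇒Support s (image s μ) (image-moved s μ moved)
    ...   | inj₁ in-s  = ⊥-elim (out (subst (λ z → Desc M z (suc s)) (sym in-s) (Desc-refl (suc s))))
    ...   | inj₂ ≡att = trans (sym (ℓ-image s μ)) (trans (cong ℓ ≡att) (ℓ-attachment s))

    InMν-moved⇒node : ∀ i k μ → InMν M (suc i , k) μ → σ i (ℓ μ) ≢ ℓ μ → μ ≡ (suc i , k)
    InMν-moved⇒node i k μ (inj₁ μ≡ν) _ = μ≡ν
    InMν-moved⇒node i k μ (inj₂ (t , (pt≡ , _) , d)) moved = ⊥-elim (¬Desc-parent t
      (subst (λ z → Desc M z (suc t)) (sym pt≡) (Support⇒Desc i t μ d (moved⇒Support i μ moved))))

    InMν-preserved : ∀ i k t → t ≢ i → ∀ μ → InMν M (suc i , k) μ →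
                     InMν M (suc i , k) (image t μ)
    InMν-preserved i k t t≢i μ μ∈ with σ t (ℓ μ) ≟ᶠ ℓ μ
    ... | yes fixed = subst (InMν M (suc i , k)) (sym (image-fixed t μ fixed)) μ∈
    InMν-preserved i k t t≢i μ (inj₁ refl) | no moved with moved⇒Support t (suc i , k) moved
    ...   | inj₁ i≡t = ⊥-elim (t≢i (Fin-suc-injective (sym i≡t)))
    ...   | inj₂ ν≡att with moved⇒Support t (image t (suc i , k)) (image-moved t (suc i , k) moved)
    ...     | inj₁ in-t  = inj₂ (t , ≡attachment⇒Attached (sym ν≡att) ,
                                 subst (λ z → Desc M z (suc t)) (sym in-t) (Desc-refl (suc t)))
    ...     | inj₂ ≡att = inj₁ (trans ≡att (sym ν≡att))
    InMν-preserved i k t t≢i μ (inj₂ (t₀ , att , d)) | no moved with image-InMs t t₀ μ d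
    ...   | inj₁ d′           = inj₂ (t₀ , att , d′)
    ...   | inj₂ (refl , ≡att) = inj₁ (trans ≡att (Attached⇒≡attachment att))

    lift-preserved : (X : Node f → Set) (i : Fin n) → (∀ t → t ≢ i → ∀ μ → X μ → X (image t μ)) →
                     PreservedExcept (X ∘ ℓ⁻¹) i
    lift-preserved X i pres t t≢i x x∈ =
      subst (λ z → X (ℓ⁻¹ (σ t z))) (ℓ-ℓ⁻¹ x) (pres t t≢i (ℓ⁻¹ x) x∈)

    ℓ⁻¹-zero : ℓ⁻¹ zero ≡ root
    ℓ⁻¹-zero = trans (cong ℓ⁻¹ (sym ℓ-root)) (ℓ⁻¹-ℓ root)

    LeftOnceByτ : (Node f → Set) → Set
    LeftOnceByτ X = ∀ μ μ′ → X μ → X μ′ → ¬ X (ℓ⁻¹ (tau m (ℓ μ))) → ¬ X (ℓ⁻¹ (tau m (ℓ μ′))) → μ ≡ μ′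

    module LabelInterval (X : Node f → Set) (X? : ∀ μ → Dec (X μ)) (root∉X : ¬ X root)
                         (μ₀ : Node f) (μ₀∈X : X μ₀) (exit-unique : LeftOnceByτ X) where

      private
        P : ℕ → Set
        P = LabelsOf ℓ X

        ¬X-label-1 : ∀ {y} → y ≡ zero → ¬ X (ℓ⁻¹ y)
        ¬X-label-1 refl 1∈X = root∉X (subst X ℓ⁻¹-zero 1∈X)

        P? : ∀ y → Dec (P y)
        P? zero = no λ ()
        P? (suc y) with y <? suc m
        ... | no  y≮d = no λ (μ , _ , eq) → y≮d (subst (_< suc m) (suc-injective eq) (toℕ<n (ℓ μ)))
        ... | yes y<d with X? (ℓ⁻¹ (fromℕ< y<d))
        ...   | yes x∈ = yes (ℓ⁻¹ (fromℕ< y<d) , x∈ , trans (lab-ℓ⁻¹ _) (cong suc (toℕ-fromℕ< y<d)))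
        ...   | no  x∉ = no λ (μ , μ∈ , eq) → x∉ (subst X (sym (ℓ⁻¹-y≡μ μ eq)) μ∈)
          where
            ℓ⁻¹-y≡μ : ∀ μ → lab ℓ μ ≡ suc y → ℓ⁻¹ (fromℕ< y<d) ≡ μ
            ℓ⁻¹-y≡μ μ eq = trans (cong ℓ⁻¹ (toℕ-injective (trans (toℕ-fromℕ< y<d) (sym (suc-injective eq)))))
                                 (ℓ⁻¹-ℓ μ)

        P-bounded : ∀ y → P y → y ≤ suc m
        P-bounded y (μ , _ , refl) = toℕ<n (ℓ μ)

        τ-leaves : ∀ μ → X μ → ¬ P (suc (lab ℓ μ)) → ¬ X (ℓ⁻¹ (tau m (ℓ μ)))
        τ-leaves μ μ∈ next∉ τμ∈ with tau-cases (ℓ μ)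
        ... | inj₁ (_ , τμ≡) = next∉ (ℓ⁻¹ (tau m (ℓ μ)) , τμ∈ , trans (lab-ℓ⁻¹ _) (cong suc τμ≡))
        ... | inj₂ (_ , τμ≡0) = ¬X-label-1 τμ≡0 τμ∈

        abstract
          interval : Σ[ a ∈ ℕ ] Σ[ b ∈ ℕ ] (IsInterval P a b × a ≤ b)
          interval = single-exit⇒interval P? (suc m) P-bounded (lab ℓ μ₀) (μ₀ , μ₀∈X , refl) exit-unique′
            where
              exit-unique′ : ∀ x x′ → Exit P x → Exit P x′ → x ≡ x′
              exit-unique′ _ _ ((μ , μ∈ , refl) , next∉) ((μ′ , μ′∈ , refl) , next′∉) =
                cong (lab ℓ) (exit-unique μ μ′ μ∈ μ′∈ (τ-leaves μ μ∈ next∉) (τ-leaves μ′ μ′∈ next′∉))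

      a b : ℕ
      a = proj₁ interval
      b = proj₁ (proj₂ interval)

      is-interval : IsInterval (LabelsOf ℓ X) a b
      is-interval = proj₁ (proj₂ (proj₂ interval))

      a≤b : a ≤ b
      a≤b = proj₂ (proj₂ (proj₂ interval))

      in-range : ∀ μ → X μ → a ≤ lab ℓ μ × lab ℓ μ ≤ b
      in-range μ μ∈ = proj₁ (is-interval (lab ℓ μ)) (μ , μ∈ , refl)

      from-range : ∀ μ → a ≤ lab ℓ μ → lab ℓ μ ≤ b → X μ
      from-range μ a≤ ≤b with μ′ , μ′∈ , eq ← proj₂ (is-interval (lab ℓ μ)) (a≤ , ≤b) =
        subst X (lab-injective eq) μ′∈

      range : 1 ≤ a × a ≤ b × b ≤ suc m
      range with μ , _ , eq ← proj₂ (is-interval a) (≤-refl , a≤b)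
                | μ′ , μ′∈ , eq′ ← proj₂ (is-interval b) (a≤b , ≤-refl) =
        subst (1 ≤_) eq (s≤s z≤n) , a≤b , subst (_≤ suc m) eq′ (toℕ<n (ℓ μ′))

      last-node : Σ[ μ ∈ Node f ] (X μ × lab ℓ μ ≡ b × ¬ X (ℓ⁻¹ (tau m (ℓ μ))))
      last-node with μ , μ∈ , lab≡b ← proj₂ (is-interval b) (a≤b , ≤-refl) =
        μ , μ∈ , lab≡b , τμ∉
        where
          τμ∉ : ¬ X (ℓ⁻¹ (tau m (ℓ μ)))
          τμ∉ τμ∈ with tau-cases (ℓ μ)
          ... | inj₁ (_ , τμ≡) = <-irrefl refl
                (subst (_≤ b) (trans (lab-ℓ⁻¹ _) (cong suc (trans τμ≡ lab≡b))) (proj₂ (in-range _ τμ∈)))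
          ... | inj₂ (_ , τμ≡0) = ¬X-label-1 τμ≡0 τμ∈

      entry : ∀ z → ¬ X (ℓ⁻¹ z) → X (ℓ⁻¹ (tau m z)) → label⁺ (tau m z) ≡ a
      entry z z∉ τz∈ =
        trans (label⁺-≢zero _ τz≢0) (≤-antisym τz≤a (subst (a ≤_) (lab-ℓ⁻¹ _) a≤τz))
        where
          τz≢0 : tau m z ≢ zero
          τz≢0 τz≡0 = ¬X-label-1 τz≡0 τz∈
          a≤τz = proj₁ (in-range _ τz∈)
          lab-τz : lab ℓ (ℓ⁻¹ (tau m z)) ≡ suc (lab ℓ (ℓ⁻¹ z))
          lab-τz = trans (lab-ℓ⁻¹ _) (cong suc (trans (tau-≢zero z τz≢0) (sym (lab-ℓ⁻¹ z))))
          z<b : lab ℓ (ℓ⁻¹ z) < b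
          z<b = subst (_≤ b) lab-τz (proj₂ (in-range _ τz∈))
          τz≤a : suc (toℕ (tau m z)) ≤ a
          τz≤a with a ≤? lab ℓ (ℓ⁻¹ z)
          ... | yes a≤z = ⊥-elim (z∉ (from-range (ℓ⁻¹ z) a≤z (<⇒≤ z<b)))
          ... | no  a≰z = subst (_≤ a) (trans (sym lab-τz) (lab-ℓ⁻¹ _)) (≰⇒> a≰z)

    -- τ = σ_0 ⋯ σ_{n-1} leaves a subtree X only through the factor of its top vertex, which leaves
    -- X only at one label; as each σ_t is injective, τ leaves X only at one label.
    exit-through-unique : (X : Node f → Set) (i : Fin n) → PreservedExcept (X ∘ ℓ⁻¹) i →
      (∀ y y′ → X (ℓ⁻¹ y) → ¬ X (ℓ⁻¹ (σ i y)) → X (ℓ⁻¹ y′) → ¬ X (ℓ⁻¹ (σ i y′)) → σ i y ≡ σ i y′) →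
      LeftOnceByτ X
    exit-through-unique X i pres σ-exit-unique μ μ′ μ∈ μ′∈ τμ∉ τμ′∉ =
      ℓ-injective (after-injective i (σ-injective i
        (σ-exit-unique _ _ (proj₁ exit) (proj₂ exit) (proj₁ exit′) (proj₂ exit′))))
      where
        exit  = exit-through pres (ℓ μ)  (subst X (sym (ℓ⁻¹-ℓ μ)) μ∈)  τμ∉
        exit′ = exit-through pres (ℓ μ′) (subst X (sym (ℓ⁻¹-ℓ μ′)) μ′∈) τμ′∉

    module VertexInterval (s : Fin n) where

      X : Node f → Set
      X = InMs M (suc s)

      preserved : PreservedExcept (X ∘ ℓ⁻¹) s
      preserved = lift-preserved X s (InMs-preserved s)

      σ-exit : ∀ y → X (ℓ⁻¹ y) → ¬ X (ℓ⁻¹ (σ s y)) → σ s y ≡ pS s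
      σ-exit y y∈ σy∉ = subst (λ z → σ s z ≡ pS s) (ℓ-ℓ⁻¹ y)
        (InMs-exit s (ℓ⁻¹ y) y∈ (λ x → σy∉ (subst (λ z → X (ℓ⁻¹ (σ s z))) (ℓ-ℓ⁻¹ y) x)))

      left-once : LeftOnceByτ X
      left-once = exit-through-unique X s preserved λ y y′ y∈ σy∉ y′∈ σy′∉ →
        trans (σ-exit y y∈ σy∉) (sym (σ-exit y′ y′∈ σy′∉))

      open LabelInterval X (InMs? (suc s)) (¬InMs-root {s} {zero}) (suc s , first-node s)
                         (Desc-refl (suc s)) left-once public

      pS∉X : ¬ X (ℓ⁻¹ (pS s))
      pS∉X pS∈ =
        ¬Desc-parent s (subst X (trans (cong ℓ⁻¹ (sym (ℓ-attachment s))) (ℓ⁻¹-ℓ (attachment s))) pS∈)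

      label⁺-exit : label⁺ (prefix (toℕ s) (pS s)) ≡ suc b
      label⁺-exit = begin
          label⁺ (prefix (toℕ s) (pS s))
            ≡⟨ cong (label⁺ ∘ prefix (toℕ s)) (sym (σ-exit _ (proj₁ exit) (proj₂ exit))) ⟩
          label⁺ (prefix (toℕ s) (σ s (after s (ℓ μ))))
            ≡⟨ cong label⁺ (sym (π≡prefix∘σ∘after s (ℓ μ))) ⟩
          label⁺ (tau m (ℓ μ))
            ≡⟨ label⁺-tau (ℓ μ) ⟩
          suc (lab ℓ μ)
            ≡⟨ cong suc (proj₁ (proj₂ (proj₂ last-node))) ⟩
          suc b
            ∎
        where
          μ = proj₁ last-node
          exit = exit-through preserved (ℓ μ) (subst X (sym (ℓ⁻¹-ℓ μ)) (proj₁ (proj₂ last-node)))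
                                              (proj₂ (proj₂ (proj₂ last-node)))

      label⁺-entry : label⁺ (prefix (suc (toℕ s)) (pS s)) ≡ a
      label⁺-entry = trans (cong label⁺ (sym τz≡)) (entry z z∉ τz∈)
        where
          z = tau⁻¹ (prefix (suc (toℕ s)) (pS s))
          τz≡ : tau m z ≡ prefix (suc (toℕ s)) (pS s)
          τz≡ = tau-tau⁻¹ _
          z∉ : ¬ X (ℓ⁻¹ z)
          z∉ z∈ = pS∉X (subst (X ∘ ℓ⁻¹) (π≡prefix⇒suffix≡ (suc (toℕ s)) (toℕ<n s) z (pS s) τz≡)
                                (after-preserves preserved z z∈))
          σpS∈ : X (ℓ⁻¹ (σ s (pS s)))
          σpS∈ with moved⇒Support s (image s (attachment s)) (image-moved s (attachment s) att-moved)
            where att-moved = subst (λ y → σ s y ≢ y) (sym (ℓ-attachment s)) (pS-adj s)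
          ... | inj₁ in-s = subst (λ y → X (ℓ⁻¹ (σ s y))) (ℓ-attachment s)
                                  (subst (λ v → Desc M v (suc s)) (sym in-s) (Desc-refl (suc s)))
          ... | inj₂ ≡att = ⊥-elim (pS-adj s (begin
                σ s (pS s)                  ≡⟨ cong (σ s) (sym (ℓ-attachment s)) ⟩
                σ s (ℓ (attachment s))      ≡⟨ sym (ℓ-image s (attachment s)) ⟩
                ℓ (image s (attachment s))  ≡⟨ cong ℓ ≡att ⟩
                ℓ (attachment s)            ≡⟨ ℓ-attachment s ⟩
                pS s                        ∎))
          τz∈ : X (ℓ⁻¹ (tau m z))
          τz∈ = subst (X ∘ ℓ⁻¹) (sym (trans τz≡ (prefix-suc s (pS s))))
                      (prefix-preserves preserved _ σpS∈)

    module NodeInterval (i : Fin n) (k : Fin (e i ∸ 1)) where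

      ν : Node f
      ν = suc i , k

      X : Node f → Set
      X = InMν M ν

      preserved : PreservedExcept (X ∘ ℓ⁻¹) i
      preserved = lift-preserved X i (InMν-preserved i k)

      ν∈X : X (ℓ⁻¹ (ℓ ν))
      ν∈X = subst X (sym (ℓ⁻¹-ℓ ν)) (inj₁ refl)

      in-X-moved⇒ν : ∀ y → X (ℓ⁻¹ y) → σ i y ≢ y → y ≡ ℓ ν
      in-X-moved⇒ν y y∈ moved = trans (sym (ℓ-ℓ⁻¹ y))
        (cong ℓ (InMν-moved⇒node i k (ℓ⁻¹ y) y∈ (subst (λ z → σ i z ≢ z) (sym (ℓ-ℓ⁻¹ y)) moved)))

      σ-exit : ∀ y → X (ℓ⁻¹ y) → ¬ X (ℓ⁻¹ (σ i y)) → y ≡ ℓ ν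
      σ-exit y y∈ σy∉ = in-X-moved⇒ν y y∈ (λ fixed → σy∉ (subst (X ∘ ℓ⁻¹) (sym fixed) y∈))

      left-once : LeftOnceByτ X
      left-once = exit-through-unique X i preserved λ y y′ y∈ σy∉ y′∈ σy′∉ →
        cong (σ i) (trans (σ-exit y y∈ σy∉) (sym (σ-exit y′ y′∈ σy′∉)))

      open LabelInterval X (InMν? ν) (¬InMν-root {i} {k} {zero}) ν (inj₁ refl) left-once public

      label⁺-exit : label⁺ (prefix (suc (toℕ i)) (ℓ ν)) ≡ suc b
      label⁺-exit = begin
          label⁺ (prefix (suc (toℕ i)) (ℓ ν))
            ≡⟨ cong label⁺ (prefix-suc i (ℓ ν)) ⟩
          label⁺ (prefix (toℕ i) (σ i (ℓ ν)))
            ≡⟨ cong (label⁺ ∘ prefix (toℕ i) ∘ σ i) (sym (σ-exit _ (proj₁ exit) (proj₂ exit))) ⟩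
          label⁺ (prefix (toℕ i) (σ i (after i (ℓ μ))))
            ≡⟨ cong label⁺ (sym (π≡prefix∘σ∘after i (ℓ μ))) ⟩
          label⁺ (tau m (ℓ μ))
            ≡⟨ label⁺-tau (ℓ μ) ⟩
          suc (lab ℓ μ)
            ≡⟨ cong suc (proj₁ (proj₂ (proj₂ last-node))) ⟩
          suc b
            ∎
        where
          μ = proj₁ last-node
          exit = exit-through preserved (ℓ μ) (subst X (sym (ℓ⁻¹-ℓ μ)) (proj₁ (proj₂ last-node)))
                                              (proj₂ (proj₂ (proj₂ last-node)))

      label⁺-entry : label⁺ (prefix (toℕ i) (ℓ ν)) ≡ a
      label⁺-entry = trans (cong label⁺ (sym τz≡)) (entry z z∉ τz∈)
        where
          z = tau⁻¹ (prefix (toℕ i) (ℓ ν))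
          τz≡ : tau m z ≡ prefix (toℕ i) (ℓ ν)
          τz≡ = tau-tau⁻¹ _
          z∉ : ¬ X (ℓ⁻¹ z)
          z∉ z∈ = σ-moves-own i k (trans (cong (σ i) (sym y≡ν)) σy≡ν)
            where
              y = after i z
              y∈ : X (ℓ⁻¹ y)
              y∈ = after-preserves preserved z z∈
              σy≡ν : σ i y ≡ ℓ ν
              σy≡ν = trans (sym (suffix-toℕ i z))
                           (π≡prefix⇒suffix≡ (toℕ i) (<⇒≤ (toℕ<n i)) z (ℓ ν) τz≡)
              y≡ν : y ≡ ℓ ν
              y≡ν with σ i y ≟ᶠ y
              ... | yes fixed = trans (sym fixed) σy≡ν
              ... | no  moved = in-X-moved⇒ν y y∈ moved
          τz∈ : X (ℓ⁻¹ (tau m z))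
          τz∈ = subst (X ∘ ℓ⁻¹) (sym τz≡) (prefix-preserves preserved _ ν∈X)

    αV βV : Fin (suc n) → ℕ
    αV zero    = 1
    αV (suc s) = VertexInterval.a s
    βV zero    = suc m
    βV (suc s) = VertexInterval.b s

    αN βN : Node f → ℕ
    αN (zero  , _) = 1
    αN (suc i , k) = NodeInterval.a i k
    βN (zero  , _) = suc m
    βN (suc i , k) = NodeInterval.b i k

    open Sequences αV βV

    module Step (c : ℕ) (c<n : c < n) where
      i : Fin n
      i = fromℕ< c<n
      w : Fin (suc n)
      w = suc i
      toℕ-i : toℕ i ≡ c
      toℕ-i = toℕ-fromℕ< c<n
      toℕ-w : toℕ w ≡ suc c
      toℕ-w = cong suc toℕ-i

      attached-crossing : ∀ v k → attachedᵇ M v k w ≡ true →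
        label⁺ (prefix c (ℓ (v , k))) ≡ suc (βV w) × label⁺ (prefix (suc c) (ℓ (v , k))) ≡ αV w
      attached-crossing v k att =
        subst (λ c′ → label⁺ (prefix c′ (ℓ (v , k))) ≡ suc (βV w)) toℕ-i
              (trans (cong (label⁺ ∘ prefix (toℕ i)) ℓ≡pS) (VertexInterval.label⁺-exit i)) ,
        subst (λ c′ → label⁺ (prefix (suc c′) (ℓ (v , k))) ≡ αV w) toℕ-i
              (trans (cong (label⁺ ∘ prefix (suc (toℕ i))) ℓ≡pS) (VertexInterval.label⁺-entry i))
        where
          ℓ≡pS : ℓ (v , k) ≡ pS i
          ℓ≡pS = trans (cong ℓ (sym (Attached⇒≡attachment (attachedᵇ⇒Attached att)))) (ℓ-attachment i)

      unattached-fixed : ∀ v k → attachedᵇ M v k w ≡ false → v ≢ w →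
                         prefix (suc c) (ℓ (v , k)) ≡ prefix c (ℓ (v , k))
      unattached-fixed v k ¬att v≢w with σ i (ℓ (v , k)) ≟ᶠ ℓ (v , k)
      ... | yes fixed = trans (cong (prefix c) (factor-< σ c<n _)) (cong (prefix c) fixed)
      ... | no  moved with moved⇒Support i (v , k) moved
      ...   | inj₁ v≡w  = ⊥-elim (v≢w v≡w)
      ...   | inj₂ ≡att with () ← trans (sym ¬att) (Attached⇒attachedᵇ (≡attachment⇒Attached (sym ≡att)))

      step-past : ∀ v k (p : Fin (suc n) → Bool) → p w ≡ true → v ≢ w →
                  (rest : List (ℕ × ℕ)) → ∀ hi → let ys = filterᵇ p (attachedTo (v , k)) in
        Consec (label⁺ (prefix c (ℓ (v , k)))) (intervalsOf (filterᵇ (below (suc c)) ys) ++ rest) hi →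
        Consec (label⁺ (prefix (suc c) (ℓ (v , k)))) (intervalsOf (filterᵇ (below (suc (suc c))) ys) ++ rest) hi
      step-past v k p pw v≢w rest hi cs with attachedᵇ M v k w in att
      ... | true =
        subst (λ L → Consec (label⁺ (prefix (suc c) (ℓ (v , k)))) (map interval L ++ rest) hi)
              (sym (reverse-filterᵇ-below-suc-∈ w ys toℕ-w (attached-sorted p) (∈-attached p att pw)))
              (sym (proj₂ crossing) , VertexInterval.a≤b i ,
               subst (λ s → Consec s (intervalsOf (filterᵇ (below (suc c)) ys) ++ rest) hi) (proj₁ crossing) cs)
        where
          ys = filterᵇ p (attachedTo (v , k))
          crossing = attached-crossing v k att
      ... | false =
        subst (λ L → Consec (label⁺ (prefix (suc c) (ℓ (v , k)))) (map interval L ++ rest) hi)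
              (sym (reverse-filterᵇ-below-suc-∉ w ys toℕ-w (attached-sorted p) (∉-attached p att)))
              (subst (λ x → Consec (label⁺ x) (intervalsOf (filterᵇ (below (suc c)) ys) ++ rest) hi)
                     (sym (unattached-fixed v k att v≢w)) cs)
        where ys = filterᵇ p (attachedTo (v , k))

    prefix-n≡tau : ∀ x → prefix n x ≡ tau m x
    prefix-n≡tau x = trans (sym (prod≡segment σ x)) (product x)

    all-processed-R : ∀ μ → filterᵇ (below (suc n)) (attachedRight μ) ≡ attachedRight μ
    all-processed-R μ =
      filterᵇ-all (below (suc n)) (All.universal (λ u → <⇒<ᵇ≡true (toℕ<n u)) (attachedRight μ))

    sequence-R : ∀ c → c ≤ n → ∀ μ → toℕ (proj₁ μ) ≤ c →
                 Consec (label⁺ (prefix c (ℓ μ))) (remainingR c μ) (βN μ)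
    sequence-R zero _ (zero , zero) _ =
      subst (λ L → Consec (label⁺ (ℓ root)) (intervalsOf L) (suc m))
            (sym (no-vertex-0-attached zero zero (above 0) (allFin (suc n)))) (cong label⁺ ℓ-root)
    sequence-R (suc c) c+1≤n (v , k) v≤c+1 with m≤n⇒m<n∨m≡n v≤c+1
    sequence-R (suc c) c+1≤n (suc i , k) _ | inj₂ i+1≡c+1 =
      subst (λ L → Consec (label⁺ (prefix (suc c) (ℓ ν))) (intervalsOf L) (βN ν)) (sym nothing-remains)
            (subst (λ c′ → label⁺ (prefix (suc c′) (ℓ ν)) ≡ suc (βN ν)) (suc-injective i+1≡c+1)
                   (NodeInterval.label⁺-exit i k))
      where
        ν = suc i , k
        nothing-remains : filterᵇ (below (suc (suc c))) (attachedRight ν) ≡ []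
        nothing-remains = subst (λ t → filterᵇ (below (suc t)) (attachedRight ν) ≡ []) i+1≡c+1
                                (filterᵇ-below-above (suc (toℕ i)) (attachedTo ν))
    sequence-R (suc c) c+1≤n (v , k) _ | inj₁ v<c+1 =
      subst (λ L → Consec (label⁺ (prefix (suc c) (ℓ (v , k)))) L (βN (v , k))) (++-identityʳ _)
        (Step.step-past c c+1≤n v k (above (toℕ v)) (<⇒<ᵇ≡true v<w) (λ v≡w → <-irrefl (cong toℕ v≡w) v<w)
          [] (βN (v , k))
          (subst (λ L → Consec (label⁺ (prefix c (ℓ (v , k)))) L (βN (v , k))) (sym (++-identityʳ _))
                 (sequence-R c (≤-trans (n≤1+n c) c+1≤n) (v , k) (≤-pred v<c+1))))
      where
        v<w : toℕ v < toℕ (Step.w c c+1≤n)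
        v<w = subst (toℕ v <_) (sym (Step.toℕ-w c c+1≤n)) v<c+1

    after-all-R : ∀ μ → Consec (suc (lab ℓ μ)) (intervalsOf (attachedRight μ)) (βN μ)
    after-all-R μ = subst₂ (λ s L → Consec s (intervalsOf L) (βN μ))
                           (trans (cong label⁺ (prefix-n≡tau (ℓ μ))) (label⁺-tau (ℓ μ))) (all-processed-R μ)
                           (sequence-R n ≤-refl μ (≤-pred (toℕ<n (proj₁ μ))))

    sequence-L : ∀ c μ → c < toℕ (proj₁ μ) → Consec (label⁺ (prefix c (ℓ μ))) (remainingL c μ) (βN μ)
    sequence-L zero (suc i , k) _ =
      subst (λ L → Consec (label⁺ (ℓ ν)) (intervalsOf L ++ point ν ∷ intervalsOf (attachedRight ν)) (βN ν))
            (sym (no-vertex-0-attached (suc i) k (below (suc (toℕ i))) (allFin (suc n))))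
            (sym (label⁺-≢zero (ℓ ν) ℓν≢0) , ≤-refl , after-all-R ν)
      where
        ν = suc i , k
        ℓν≢0 : ℓ ν ≢ zero
        ℓν≢0 eq with () ← ℓ-injective (trans eq (sym ℓ-root))
    sequence-L (suc c) (v , k) c+1<v =
      Step.step-past c c<n v k (below (toℕ v)) (<⇒<ᵇ≡true w<v) (λ v≡w → <-irrefl (cong toℕ (sym v≡w)) w<v)
        (point (v , k) ∷ intervalsOf (attachedRight (v , k))) (βN (v , k))
        (sequence-L c (v , k) (<-trans (n<1+n c) c+1<v))
      where
        c<n : c < n
        c<n = <-≤-trans (<-trans (n<1+n c) c+1<v) (≤-pred (toℕ<n v))
        w<v : toℕ (Step.w c c<n) < toℕ v
        w<v = subst (_< toℕ v) (sym (Step.toℕ-w c c<n)) c+1<v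

    cond-iii : ∀ μ → Consec (αN μ) (intervals μ) (βN μ)
    cond-iii (zero , zero) =
      subst (λ L → Consec 1 (intervalsOf L ++ point root ∷ intervalsOf (attachedRight root)) (suc m))
            (sym (filterᵇ-none (below 0) (All.universal (λ _ → refl) (attachedTo root))))
            (cong (suc ∘ toℕ) ℓ-root , ≤-refl , after-all-R root)
    cond-iii (suc i , k) =
      subst₂ (λ s L → Consec s (intervalsOf L ++ point ν ∷ intervalsOf (attachedRight ν)) (βN ν))
             (NodeInterval.label⁺-entry i k) all-processed-L (sequence-L (toℕ i) ν ≤-refl)
      where
        ν = suc i , k
        all-processed-L : filterᵇ (below (suc (toℕ i))) (attachedLeft ν) ≡ attachedLeft ν
        all-processed-L = filter-idem (T? ∘ below (suc (toℕ i))) (attachedTo ν)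

    all-labels : (X : Node f → Set) → (∀ μ → X μ) → IsInterval (LabelsOf ℓ X) 1 (suc m)
    all-labels X all y = (λ { (μ , _ , refl) → s≤s z≤n , toℕ<n (ℓ μ) }) ,
                         (λ { (s≤s z≤n , s≤s y≤m) → in-X y≤m })
      where
        in-X : ∀ {y} → y ≤ m → LabelsOf ℓ X (suc y)
        in-X y≤m = ℓ⁻¹ (fromℕ< (s≤s y≤m)) , all _ ,
                   trans (lab-ℓ⁻¹ _) (cong suc (toℕ-fromℕ< (s≤s y≤m)))

    InMν-root-all : ∀ μ → InMν M root μ
    InMν-root-all (zero , k) = inj₁ (root-unique k)
    InMν-root-all (suc v , k) with t , pt≡0 , d ← Desc-child (rooted (suc v)) (λ ())
                              with zero , att ← attached-to-parent pt≡0 = inj₂ (t , att , d)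

    cond-i : ∀ ν → IsInterval (LabelsOf ℓ (InMν M ν)) (αN ν) (βN ν)
    cond-i (zero  , zero) = all-labels (InMν M root) InMν-root-all
    cond-i (suc i , k)    = NodeInterval.is-interval i k

    cond-ii : ∀ j → IsInterval (LabelsOf ℓ (InMs M j)) (αV j) (βV j)
    cond-ii zero    = all-labels (InMs M zero) (λ μ → rooted (proj₁ μ))
    cond-ii (suc s) = VertexInterval.is-interval s

    range-N : ∀ ν → 1 ≤ αN ν × αN ν ≤ βN ν × βN ν ≤ suc m
    range-N (zero  , zero) = s≤s z≤n , s≤s z≤n , ≤-refl
    range-N (suc i , k)    = NodeInterval.range i k

    range-V : ∀ j → 1 ≤ αV j × αV j ≤ βV j × βV j ≤ suc m
    range-V zero    = s≤s z≤n , s≤s z≤n , ≤-refl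
    range-V (suc s) = VertexInterval.range s

    module NodesOfVertex (i : Fin n) where
      open VertexInterval i using (a; b; a≤b; in-range; is-interval)

      node-in-range : ∀ k μ → InMν M (suc i , k) μ →
                      αN (suc i , k) ≤ lab ℓ μ × lab ℓ μ ≤ βN (suc i , k)
      node-in-range k = NodeInterval.in-range i k

      node-interval : ∀ k →
                      IsInterval (LabelsOf ℓ (InMν M (suc i , k))) (αN (suc i , k)) (βN (suc i , k))
      node-interval k = NodeInterval.is-interval i k

      node-a≤b : ∀ k → αN (suc i , k) ≤ βN (suc i , k)
      node-a≤b k = NodeInterval.a≤b i k

      inside : ∀ k → a ≤ αN (suc i , k) × αN (suc i , k) ≤ βN (suc i , k) × βN (suc i , k) ≤ b
      inside k = proj₁ (within (αN (suc i , k)) ≤-refl (node-a≤b k)) , node-a≤b k ,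
                 proj₂ (within (βN (suc i , k)) (node-a≤b k) ≤-refl)
        where
          within : ∀ z → αN (suc i , k) ≤ z → z ≤ βN (suc i , k) → a ≤ z × z ≤ b
          within z a≤z z≤b with μ , μ∈ , refl ← proj₂ (node-interval k z) (a≤z , z≤b) =
            in-range μ (InMν⊆InMs μ∈)

      sorted : ∀ k k′ → toℕ k < toℕ k′ → βN (suc i , k) < αN (suc i , k′)
      sorted k k′ k<k′ =
        disjoint-intervals-ordered (proj₁ ν∈) (proj₂ ν∈) (proj₁ ν′∈) (proj₂ ν′∈) labels<
          λ z a≤z z≤b a′≤z z≤b′ →
            disjoint (proj₂ (node-interval k z) (a≤z , z≤b)) (proj₂ (node-interval k′ z) (a′≤z , z≤b′))
        where
          ν∈  = node-in-range k  (suc i , k)  (inj₁ refl)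
          ν′∈ = node-in-range k′ (suc i , k′) (inj₁ refl)
          labels< : lab ℓ (suc i , k) < lab ℓ (suc i , k′)
          labels< = s≤s (subst₂ (λ u v → toℕ u < toℕ v) (sym (ℓ-children i k)) (sym (ℓ-children i k′))
                                (children-increasing i k k′ k<k′))
          disjoint : ∀ {z} → LabelsOf ℓ (InMν M (suc i , k)) z → LabelsOf ℓ (InMν M (suc i , k′)) z → ⊥
          disjoint (μ , μ∈ , refl) (μ′ , μ′∈ , eq) =
            InMν-disjoint (λ k≡k′ → <-irrefl (cong toℕ k≡k′) k<k′) μ∈
                          (subst (InMν M (suc i , k′)) (lab-injective eq) μ′∈)

      covered : ∀ z → a ≤ z → z ≤ b → ∃[ k ] (αN (suc i , k) ≤ z × z ≤ βN (suc i , k))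
      covered z a≤z z≤b = node-covers (proj₂ (is-interval z) (a≤z , z≤b))
        where
          node-covers : LabelsOf ℓ (InMs M (suc i)) z →
                        ∃[ k ] (αN (suc i , k) ≤ z × z ≤ βN (suc i , k))
          node-covers ((v , k) , d , refl) with v ≟ᶠ suc i
          ... | yes refl = k , node-in-range k (suc i , k) (inj₁ refl)
          ... | no  v≢i  =
            let t , pt≡ , d′ = Desc-child d v≢i
                k′ , att     = attached-to-parent pt≡
            in k′ , node-in-range k′ (v , k) (inj₂ (t , att , d′))

      nodes : Fin (e i ∸ 1) → ℕ × ℕ
      nodes k = αN (suc i , k) , βN (suc i , k)

      consecutive : Consec a (map nodes (allFin (e i ∸ 1))) b
      consecutive = subst (λ L → Consec a L b) (sym (map-tabulate (λ k → k) nodes))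
                          (Consec-tabulate⁺ nodes a b (≤-trans a≤b (n≤1+n b)) inside sorted covered)

    cond-iv : ∀ j → Consec (αV j) (map (λ k → (αN (j , k) , βN (j , k))) (allFin (f j))) (βV j)
    cond-iv zero    = refl , s≤s z≤n , refl
    cond-iv (suc i) = NodesOfVertex.consecutive i

    conditions : LMRConditions M ℓ
    conditions =
      αN , βN , αV , βV , range-N , range-V , cond-i , cond-ii , (λ j k → cond-iii (j , k)) , cond-iv

lemma5p7 : (m n : ℕ) → 1 ≤ n
    → (e : Fin n → ℕ) → (∀ i → 2 ≤ e i) → sum (tabulate (λ i → e i ∸ 1)) ≡ m
    → (s : Fin n → ℕ) → (∀ i j → toℕ i < toℕ j → s i < s j) → (∀ i → suc m < s i)
    → (M : MNTree n (vdata e)) (ℓ : Node (vdata e) → Fin (suc m)) → Bijective _≡_ _≡_ ℓ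
    → InLMR M ℓ ⇔ LMRConditions M ℓ
lemma5p7 m n _ e e≥2 _ _ _ _ M ℓ ℓ-bijective = mk⇔
  (λ (F , R , ch , ch-increasing , ch-complete , ch-owned , ℓ-root , ℓ-ch , parents) →
     ToConditions.conditions e e≥2 M ℓ ℓ-bijective
       F R ch ch-increasing ch-complete ch-owned ℓ-root ℓ-ch parents)
  (λ (αN , βN , αV , βV , _ , range-V , cond-i , cond-ii , cond-iii , cond-iv) →
     FromConditions.inLMR e e≥2 M ℓ ℓ-bijective αN βN αV βV range-V cond-i cond-ii
       (λ (j , k) → cond-iii j k) cond-iv)
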